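{- Let $n\geq 5$ be odd, $N\geq n$, and $0<\ell_1<\dots<\ell_{n-1}<\ell_n=N$; set $\ell_0=0$. Let $C_{2N}$ be the cycle with nodes $v_0,\dots,v_{2N-1}$ and edges $j=v_jv_{(j+1)\bmod 2N}$ for $0\leq j<2N$, and let $S_{2N}=\{\{v_i,v_{(i+N)\bmod 2N}\}:1\leq i\leq N\}$. For $\beta\in\{1,2\}$ let $\beta'=3-\beta$, and for $1\leq j\leq n$ let $(\beta_j,\beta'_j)=(\beta,\beta')$ if $j$ is odd and $(\beta_j,\beta'_j)=(\beta',\beta)$ if $j$ is even. Then the inequality $$\sum_{j=1}^{n}\ \sum_{i=\ell_{j-1}}^{\ell_j-1}\left(\beta_j x_i+\beta'_j x_{i+N}\right)\geq 3$$ defines a shared facet of $\mathrm{MultC}(C_{2N},S_{2N})$.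
   Context: Given a graph $G=(V,E)$ and $S\subseteq\binom{V}{2}$, an ($S$-)multicut is a set $\delta\subseteq E$ such that for every $\{s,t\}\in S$ the nodes $s$ and $t$ lie in different components of $G-\delta$. For $F\subseteq E$, $x^F\in\mathbb{R}^E$ is its incidence vector. The multicut polytope is $\mathrm{MultC}^{\square}(G,S)=\mathrm{conv}\{x^\delta:\delta\text{ an } S\text{ -multicut}\}$ and the multicut dominant is $\mathrm{MultC}(G,S)=\mathrm{MultC}^{\square}(G,S)+\mathbb{R}^E_{\geq 0}$. A facet-defining inequality of $\mathrm{MultC}(G,S)$ defines a shared facet if it is also facet-defining for $\mathrm{MultC}^{\square}(G,S)$.
   Formalization: The polytope $\mathrm{MultC}^{\square}(G,S)$ and the dominant $\mathrm{MultC}(G,S)$ consist only of their points in ℚ^E rather than $\mathbb{R}^E$, and validity and dimension are judged on these rational points. -}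

module Defs where

open import Data.Nat as ℕ using (ℕ; zero; suc; _∸_; _%_; _<?_)
open import Data.Nat.DivMod using (_mod_)
open import Data.Integer using (+_)
open import Data.Rational using (ℚ; 0ℚ; 1ℚ; _+_; _*_; _≤_; _/_)
open import Data.Fin using (Fin; toℕ; fromℕ<)
open import Data.Bool using (Bool; true; false; if_then_else_)
open import Data.Product using (Σ; ∃; ∃-syntax; _×_; _,_)
open import Data.Sum using (_⊎_)
open import Data.List using (List; []; _∷_)
open import Data.List.Relation.Unary.All using (All)
open import Relation.Binary.PropositionalEquality using (_≡_)
open import Relation.Binary.Construct.Closure.ReflexiveTransitive using (Star)
open import Relation.Nullary using (¬_; yes; no)

record Graph : Set where
  field
    nV    : ℕ
    nE    : ℕ
    ends  : Fin nE → Fin nV × Fin nV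
open Graph public

EdgeSet : Graph → Set
EdgeSet G = Fin (nE G) → Bool

Step : (G : Graph) → EdgeSet G → Fin (nV G) → Fin (nV G) → Set
Step G δ u v = ∃[ e ] (δ e ≡ false × (ends G e ≡ (u , v) ⊎ ends G e ≡ (v , u)))

SameComponent : (G : Graph) → EdgeSet G → Fin (nV G) → Fin (nV G) → Set
SameComponent G δ = Star (Step G δ)

NodePairs : Graph → Set₁
NodePairs G = Fin (nV G) → Fin (nV G) → Set

IsMulticut : (G : Graph) → NodePairs G → EdgeSet G → Set
IsMulticut G S δ = ∀ s t → S s t → ¬ SameComponent G δ s t

Vecℚ : ℕ → Set
Vecℚ m = Fin m → ℚ

ℚof : ℕ → ℚ
ℚof k = + k / 1

incidence : ∀ {m} → (Fin m → Bool) → Vecℚ m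
incidence δ e = if δ e then 1ℚ else 0ℚ

sumList : ∀ {A : Set} → (A → ℚ) → List A → ℚ
sumList f []       = 0ℚ
sumList f (a ∷ as) = f a + sumList f as

InConvIncidence : ∀ {m} → ((Fin m → Bool) → Set) → Vecℚ m → Set
InConvIncidence {m} P x =
  Σ (List (ℚ × (Fin m → Bool))) λ L →
    All (λ { (w , δ) → 0ℚ ≤ w × P δ }) L
    × sumList (λ { (w , δ) → w }) L ≡ 1ℚ
    × (∀ e → x e ≡ sumList (λ { (w , δ) → w * incidence δ e }) L)

-- multicut polytope MultC□(G,S) (its rational points)
MultCBox : (G : Graph) → NodePairs G → Vecℚ (nE G) → Set
MultCBox G S = InConvIncidence (IsMulticut G S)

-- multicut dominant MultC(G,S) = MultC□(G,S) + ℝ^E_{≥0} (rational points)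
MultCDom : (G : Graph) → NodePairs G → Vecℚ (nE G) → Set
MultCDom G S x = ∃[ y ] (MultCBox G S y × (∀ e → y e ≤ x e))

sumFin : ∀ k → (Fin k → ℚ) → ℚ
sumFin zero    f = 0ℚ
sumFin (suc k) f = f Fin.zero + sumFin k (λ i → f (Fin.suc i))
  where import Data.Fin as Fin

AffinelyIndependent : ∀ {m} k → (Fin k → Vecℚ m) → Set
AffinelyIndependent k p =
  ∀ (λs : Fin k → ℚ) → sumFin k λs ≡ 0ℚ →
    (∀ e → sumFin k (λ i → λs i * p i e) ≡ 0ℚ) → ∀ i → λs i ≡ 0ℚ

HasDim : ∀ {m} → (Vecℚ m → Set) → ℕ → Set
HasDim {m} P d =
  (∃[ p ] ((∀ i → P (p i)) × AffinelyIndependent (suc d) p))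
  × (∀ (p : Fin (suc (suc d)) → Vecℚ m) → (∀ i → P (p i)) →
       ¬ AffinelyIndependent (suc (suc d)) p)

FacetDefining : ∀ {m} → (Vecℚ m → Set) → (Vecℚ m → ℚ) → ℚ → Set
FacetDefining P f b =
  (∀ x → P x → b ≤ f x)
  × ∃[ d ] (HasDim P (suc d) × HasDim (λ x → P x × f x ≡ b) d)

SharedFacet : (G : Graph) → NodePairs G → (Vecℚ (nE G) → ℚ) → ℚ → Set
SharedFacet G S f b = FacetDefining (MultCDom G S) f b × FacetDefining (MultCBox G S) f b

cycNext : ∀ {m} → Fin m → Fin m
cycNext {suc k} j = suc (toℕ j) mod suc k

Cycle : ℕ → Graph
Cycle m = record { nV = m ; nE = m ; ends = λ j → (j , cycNext j) }

-- a mod b, with the (irrelevant) convention a mod 0 = a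
_mod'_ : ℕ → ℕ → ℕ
a mod' zero  = a
a mod' suc k = a % suc k

S2N : (N : ℕ) → NodePairs (Cycle (2 ℕ.* N))
S2N N s t = ∃[ i ] (1 ℕ.≤ i × i ℕ.≤ N ×
  ((toℕ s ≡ i × toℕ t ≡ (i ℕ.+ N) mod' (2 ℕ.* N))
   ⊎ (toℕ t ≡ i × toℕ s ≡ (i ℕ.+ N) mod' (2 ℕ.* N))))

-- coordinate i of x (indices are always < m where used; 0 otherwise)
coord : ∀ {m} → Vecℚ m → ℕ → ℚ
coord {m} x i with i <? m
... | yes i<m = x (fromℕ< i<m)
... | no  _   = 0ℚ

sumFrom : ℕ → ℕ → (ℕ → ℚ) → ℚ
sumFrom a zero    f = 0ℚ
sumFrom a (suc k) f = f a + sumFrom (suc a) k f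

sumRange : ℕ → ℕ → (ℕ → ℚ) → ℚ
sumRange a b f = sumFrom a (b ∸ a) f

sum1to : ℕ → (ℕ → ℚ) → ℚ
sum1to n f = sumFrom 1 n f

betaJ : ℕ → ℕ → ℕ
betaJ β j with j % 2
... | zero = 3 ∸ β
... | suc _ = β

betaJ' : ℕ → ℕ → ℕ
betaJ' β j with j % 2
... | zero = β
... | suc _ = 3 ∸ β

cycleLHS : (n N : ℕ) (ℓ : ℕ → ℕ) (β : ℕ) → Vecℚ (2 ℕ.* N) → ℚ
cycleLHS n N ℓ β x =
  sum1to n λ j → sumRange (ℓ (j ∸ 1)) (ℓ j) λ i →
    ℚof (betaJ β j) * coord x i + ℚof (betaJ' β j) * coord x (i ℕ.+ N)

-- Write the inequality as Σ_{i<N} (α_i x_i + α′_i x_{i+N}) with {α_i, α′_i} = {1, 2}. A multicut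
-- either cuts an antipodal pair of edges i, i + N, of value 3, or has at least three cut edges:
-- with at most two cut edges and no antipodal pair cut, some antipodes v_i, v_{i+N} remain joined
-- by an uncut arc. So the inequality is valid for the polytope, and for the dominant since all
-- coefficients are positive.
-- On the face lie the multicuts formed by an antipodal pair of edges, or by three "light" edges
-- (coefficient 1) at positions y₁ < y₂ < y₃ < N whose coefficients α alternate. Take the N
-- antipodal pairs, five triples of block starts ℓ_k with k ∈ {j, j+1, j+2} mod 5, and for each
-- other position x one triple through x completed by block starts. Against the functionals x_z,
-- x_light(y) − x_heavy(y) and suitable combinations of the latter at the five block starts, these
-- 2N points form a triangular matrix with non-zero diagonal, so they are affinely independent.
-- The all-cut set, of value at least 6, adds a point off the face, so the polytope and the
-- dominant have dimension 2N and the face has dimension 2N − 1.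

module Submission where

open import Defs
open import Data.Nat as ℕ using (ℕ; zero; suc; _≤_; _<_; _∸_; z≤n; s≤s)
import Data.Nat.Properties as ℕ
open import Data.Nat.Properties using (anyUpTo?)
open import Data.Nat.DivMod using (_mod_; _%_; m<n⇒m%n≡m; n%n≡0)
open import Algebra.Properties.CommutativeSemigroup ℕ.+-commutativeSemigroup using () renaming (interchange to +-interchange)
open import Data.Fin as Fin using (Fin; zero; suc; toℕ; fromℕ<; punchIn)
open import Data.Fin.Properties using (toℕ-injective; toℕ-fromℕ<; toℕ<n; all?; any?; punchInᵢ≢i)
open import Data.Vec.Functional using (insertAt) renaming (_∷_ to _∷ᵥ_)
open import Data.Vec.Functional.Properties using (insertAt-lookup; insertAt-punchIn)
open import Data.Rational using (ℚ; 0ℚ; 1ℚ; _+_; _*_; _-_; -_; 1/_; NonZero; ≢-nonZero; nonNegative)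
  renaming (_≤_ to _≤ℚ_; _<_ to _<ℚ_)
open import Data.Rational.Properties
import Data.Rational.Properties as ℚ
open import Data.Rational.Solver using (module +-*-Solver)
open import Data.Product using (Σ; Σ-syntax; ∃; ∃-syntax; _×_; _,_; proj₁; proj₂)
open import Data.Sum using (_⊎_; inj₁; inj₂)
open import Data.Bool using (Bool; true; false; if_then_else_; _∧_; _∨_; not)
open import Data.Bool.Properties using (∧-distribʳ-∨; ∨-zeroʳ; ∨-identityʳ; ∧-identityʳ; ∧-zeroʳ)
open import Data.List using (List; []; _∷_; map; length)
open import Data.List.Relation.Unary.All using (All; []; _∷_)
open import Data.Unit using (⊤; tt)
open import Data.Empty using (⊥; ⊥-elim)
open import Function using (_∘_)
open import Relation.Nullary using (¬_; Dec; yes; no; does; ¬?)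
open import Relation.Nullary.Decidable using (True; toWitness; dec-true; dec-false; _×-dec_; _⊎-dec_)
open import Relation.Binary.PropositionalEquality
open import Relation.Binary.Definitions using (tri<; tri≈; tri>)
open import Relation.Binary.Construct.Closure.ReflexiveTransitive using (ε; _◅_; _◅◅_)

open +-*-Solver

-- Finite sums and linear algebra over ℚ

sumFin-cong : ∀ k {f g : Fin k → ℚ} → (∀ i → f i ≡ g i) → sumFin k f ≡ sumFin k g
sumFin-cong zero    f≗g = refl
sumFin-cong (suc k) f≗g = cong₂ _+_ (f≗g zero) (sumFin-cong k (λ i → f≗g (suc i)))

sumFin-zero : ∀ k {f : Fin k → ℚ} → (∀ i → f i ≡ 0ℚ) → sumFin k f ≡ 0ℚ
sumFin-zero zero    f≗0 = refl
sumFin-zero (suc k) f≗0 = cong₂ _+_ (f≗0 zero) (sumFin-zero k (λ i → f≗0 (suc i)))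

sumFin-+ : ∀ k (f g : Fin k → ℚ) → sumFin k (λ i → f i + g i) ≡ sumFin k f + sumFin k g
sumFin-+ zero    f g = refl
sumFin-+ (suc k) f g =
  trans (cong ((f zero + g zero) +_) (sumFin-+ k (λ i → f (suc i)) (λ i → g (suc i))))
        (solve 4 (λ a b c d → (a :+ b) :+ (c :+ d) := (a :+ c) :+ (b :+ d)) refl (f zero) (g zero) _ _)

sumFin-*ˡ : ∀ k c (f : Fin k → ℚ) → sumFin k (λ i → c * f i) ≡ c * sumFin k f
sumFin-*ˡ zero    c f = sym (*-zeroʳ c)
sumFin-*ˡ (suc k) c f =
  trans (cong (c * f zero +_) (sumFin-*ˡ k c (λ i → f (suc i)))) (sym (*-distribˡ-+ c (f zero) _))

sumFin-*ʳ : ∀ k c (f : Fin k → ℚ) → sumFin k (λ i → f i * c) ≡ sumFin k f * c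
sumFin-*ʳ k c f = trans (sumFin-cong k (λ i → *-comm (f i) c)) (trans (sumFin-*ˡ k c f) (*-comm c _))

sumFin-neg : ∀ k (f : Fin k → ℚ) → sumFin k (λ i → - f i) ≡ - sumFin k f
sumFin-neg zero    f = refl
sumFin-neg (suc k) f =
  trans (cong (- f zero +_) (sumFin-neg k (λ i → f (suc i)))) (sym (neg-distrib-+ (f zero) _))

sumFin-punchIn : ∀ k (i : Fin (suc k)) (f : Fin (suc k) → ℚ) →
  sumFin (suc k) f ≡ f i + sumFin k (λ j → f (punchIn i j))
sumFin-punchIn k       zero    f = refl
sumFin-punchIn (suc k) (suc i) f =
  trans (cong (f zero +_) (sumFin-punchIn k i (λ j → f (suc j))))
        (solve 3 (λ a b c → a :+ (b :+ c) := b :+ (a :+ c)) refl (f zero) (f (suc i)) _)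

sumFin-single : ∀ k (f : Fin (suc k) → ℚ) i → (∀ j → j ≢ i → f j ≡ 0ℚ) → sumFin (suc k) f ≡ f i
sumFin-single k f i others≡0 =
  trans (sumFin-punchIn k i f)
        (trans (cong (f i +_) (sumFin-zero k (λ j → others≡0 (punchIn i j) (punchInᵢ≢i i j))))
               (+-identityʳ (f i)))

sumFin-swap : ∀ a b (f : Fin a → Fin b → ℚ) →
  sumFin a (λ i → sumFin b (f i)) ≡ sumFin b (λ j → sumFin a (λ i → f i j))
sumFin-swap zero    b f = sym (sumFin-zero b (λ _ → refl))
sumFin-swap (suc a) b f =
  trans (cong (sumFin b (f zero) +_) (sumFin-swap a b (λ i → f (suc i))))
        (sym (sumFin-+ b (f zero) (λ j → sumFin a (λ i → f (suc i) j))))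

x*y≡0⇒x≡0 : ∀ x y → y ≢ 0ℚ → x * y ≡ 0ℚ → x ≡ 0ℚ
x*y≡0⇒x≡0 x y y≢0 xy≡0 = begin
  x                 ≡⟨ sym (*-identityʳ x) ⟩
  x * 1ℚ            ≡⟨ cong (x *_) (sym (*-inverseʳ y)) ⟩
  x * (y * 1/ y)    ≡⟨ sym (*-assoc x y (1/ y)) ⟩
  (x * y) * 1/ y    ≡⟨ cong (_* 1/ y) xy≡0 ⟩
  0ℚ * 1/ y         ≡⟨ *-zeroˡ (1/ y) ⟩
  0ℚ                ∎
  where
  open ≡-Reasoning
  instance y-nonZero : NonZero y
  y-nonZero = ≢-nonZero y≢0

LinearlyDependent : ∀ {k m} → (Fin k → Vecℚ m) → Set
LinearlyDependent {k} v =
  Σ[ c ∈ (Fin k → ℚ) ] (∃[ i ] c i ≢ 0ℚ) × (∀ e → sumFin k (λ i → c i * v i e) ≡ 0ℚ)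

dependent-zeroColumn : ∀ {m} (v : Fin (suc (suc m)) → Vecℚ (suc m)) → (∀ i → v i zero ≡ 0ℚ) →
  LinearlyDependent (λ i e → v (suc i) (suc e)) → LinearlyDependent v
dependent-zeroColumn {m} v column≡0 (c , (i , cᵢ≢0) , c·v≡0) = c₀ , (suc i , cᵢ≢0) , c₀·v≡0
  where
  c₀ : Fin (suc (suc m)) → ℚ
  c₀ zero    = 0ℚ
  c₀ (suc j) = c j
  c₀·v≡0 : ∀ e → sumFin (suc (suc m)) (λ j → c₀ j * v j e) ≡ 0ℚ
  c₀·v≡0 zero    = trans (cong₂ _+_ (*-zeroˡ (v zero zero))
                     (sumFin-zero (suc m) {λ j → c j * v (suc j) zero}
                       (λ j → trans (cong (c j *_) (column≡0 (suc j))) (*-zeroʳ (c j)))))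
                     refl
  c₀·v≡0 (suc e) = trans (cong (_+ sumFin (suc m) (λ j → c j * v (suc j) (suc e))) (*-zeroˡ (v zero (suc e))))
                          (trans (+-identityˡ _) (c·v≡0 e))

module Pivot {m} (v : Fin (suc (suc m)) → Vecℚ (suc m)) (k : Fin (suc (suc m)))
             (pivot≢0 : v k zero ≢ 0ℚ) where

  private instance
    pivot-nonZero : NonZero (v k zero)
    pivot-nonZero = ≢-nonZero pivot≢0

  ratio : Fin (suc m) → ℚ
  ratio i = v (punchIn k i) zero * 1/ v k zero

  eliminated : Fin (suc m) → Vecℚ m
  eliminated i e = v (punchIn k i) (suc e) - ratio i * v k (suc e)

  module _ (c : Fin (suc m) → ℚ) (c·w≡0 : ∀ e → sumFin (suc m) (λ j → c j * eliminated j e) ≡ 0ℚ) where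

    cₖ : ℚ
    cₖ = - sumFin (suc m) (λ j → c j * ratio j)

    lifted : Fin (suc (suc m)) → ℚ
    lifted = insertAt c k cₖ

    lifted-split : ∀ e → sumFin (suc (suc m)) (λ j → lifted j * v j e)
                       ≡ cₖ * v k e + sumFin (suc m) (λ j → c j * v (punchIn k j) e)
    lifted-split e = trans (sumFin-punchIn (suc m) k (λ j → lifted j * v j e))
      (cong₂ _+_ (cong (_* v k e) (insertAt-lookup c k cₖ))
                 (sumFin-cong (suc m) (λ j → cong (_* v (punchIn k j) e) (insertAt-punchIn c k cₖ j))))

    lifted-pivotColumn : sumFin (suc (suc m)) (λ j → lifted j * v j zero) ≡ 0ℚ
    lifted-pivotColumn = begin
        _                                    ≡⟨ lifted-split zero ⟩
        cₖ * p + S                           ≡⟨ cong (λ a → - a * p + S) (trans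
                                                  (sumFin-cong (suc m) (λ j → sym (*-assoc (c j) (v (punchIn k j) zero) (1/ p))))
                                                  (sumFin-*ʳ (suc m) (1/ p) (λ j → c j * v (punchIn k j) zero))) ⟩
        - (S * 1/ p) * p + S                 ≡⟨ cong (_+ S) (sym (neg-distribˡ-* (S * 1/ p) p)) ⟩
        - ((S * 1/ p) * p) + S               ≡⟨ cong (λ a → - a + S) (trans (*-assoc S (1/ p) p)
                                                  (trans (cong (S *_) (*-inverseˡ p)) (*-identityʳ S))) ⟩
        - S + S                              ≡⟨ +-inverseˡ S ⟩
        0ℚ                                   ∎
      where
      open ≡-Reasoning
      p = v k zero
      S = sumFin (suc m) (λ j → c j * v (punchIn k j) zero)

    lifted-otherColumn : ∀ e → sumFin (suc (suc m)) (λ j → lifted j * v j (suc e)) ≡ 0ℚ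
    lifted-otherColumn e = begin
        _                                    ≡⟨ lifted-split (suc e) ⟩
        cₖ * vₖ + A                          ≡⟨ cong (_+ A) (sym (neg-distribˡ-* B vₖ)) ⟩
        - (B * vₖ) + A                       ≡⟨ cong (λ a → - a + A) (sym (sumFin-*ʳ (suc m) vₖ (λ j → c j * ratio j))) ⟩
        - sumFin (suc m) (λ j → (c j * ratio j) * vₖ) + A
                                             ≡⟨ +-comm _ A ⟩
        A + - sumFin (suc m) (λ j → (c j * ratio j) * vₖ)
                                             ≡⟨ cong (A +_) (sym (sumFin-neg (suc m) (λ j → (c j * ratio j) * vₖ))) ⟩
        A + sumFin (suc m) (λ j → - ((c j * ratio j) * vₖ))
                                             ≡⟨ sym (sumFin-+ (suc m) (λ j → c j * v (punchIn k j) (suc e))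
                                                                   (λ j → - ((c j * ratio j) * vₖ))) ⟩
        sumFin (suc m) (λ j → c j * v (punchIn k j) (suc e) + - ((c j * ratio j) * vₖ))
                                             ≡⟨ sumFin-cong (suc m) (λ j →
                                                  solve 4 (λ a b x y → a :* b :+ :- ((a :* x) :* y) := a :* (b :- x :* y))
                                                    refl (c j) (v (punchIn k j) (suc e)) (ratio j) vₖ) ⟩
        sumFin (suc m) (λ j → c j * eliminated j e)
                                             ≡⟨ c·w≡0 e ⟩
        0ℚ                                   ∎
      where
      open ≡-Reasoning
      vₖ = v k (suc e)
      A = sumFin (suc m) (λ j → c j * v (punchIn k j) (suc e))
      B = sumFin (suc m) (λ j → c j * ratio j)

  dependent-pivot : LinearlyDependent eliminated → LinearlyDependent v
  dependent-pivot (c , (i , cᵢ≢0) , c·w≡0) =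
    lifted c c·w≡0 , (punchIn k i , subst (_≢ 0ℚ) (sym (insertAt-punchIn c k _ i)) cᵢ≢0) , λ
      { zero    → lifted-pivotColumn c c·w≡0
      ; (suc e) → lifted-otherColumn c c·w≡0 e }

-- Gaussian elimination on the first coordinate.
linearlyDependent : ∀ m (v : Fin (suc m) → Vecℚ m) → LinearlyDependent v
linearlyDependent zero    v = (λ _ → 1ℚ) , (zero , 1≢0) , λ ()
linearlyDependent (suc m) v with any? (λ i → ¬? (v i zero ≟ 0ℚ))
... | yes (k , pivot≢0) = dependent-pivot (linearlyDependent m eliminated)
  where open Pivot v k pivot≢0
... | no noPivot = dependent-zeroColumn v column≡0 (linearlyDependent m (λ i e → v (suc i) (suc e)))
  where
  column≡0 : ∀ i → v i zero ≡ 0ℚ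
  column≡0 i with v i zero ≟ 0ℚ
  ... | yes vᵢ≡0 = vᵢ≡0
  ... | no  vᵢ≢0 = ⊥-elim (noPivot (i , vᵢ≢0))

-- Affine dependence of p is linear dependence of the lifted vectors (1, p i).
¬AffinelyIndependent-beyondDim : ∀ m (p : Fin (suc (suc m)) → Vecℚ m) →
  ¬ AffinelyIndependent (suc (suc m)) p
¬AffinelyIndependent-beyondDim m p affInd with linearlyDependent (suc m) (λ i → 1ℚ ∷ᵥ p i)
... | c , (i , cᵢ≢0) , c·w≡0 = cᵢ≢0 (affInd c Σc≡0 (λ e → c·w≡0 (suc e)) i)
  where
  Σc≡0 : sumFin (suc (suc m)) c ≡ 0ℚ
  Σc≡0 = trans (sumFin-cong (suc (suc m)) (λ j → sym (*-identityʳ (c j)))) (c·w≡0 zero)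

record IsLinear {m} (f : Vecℚ m → ℚ) : Set where
  field
    resp-≗ : ∀ {x y} → x ≗ y → f x ≡ f y
    homo-0 : f (λ _ → 0ℚ) ≡ 0ℚ
    homo-+ : ∀ x y → f (λ e → x e + y e) ≡ f x + f y
    homo-* : ∀ a x → f (λ e → a * x e) ≡ a * f x

  homo-sumFin : ∀ k (c : Fin k → ℚ) (p : Fin k → Vecℚ m) →
    f (λ e → sumFin k (λ i → c i * p i e)) ≡ sumFin k (λ i → c i * f (p i))
  homo-sumFin zero    c p = homo-0
  homo-sumFin (suc k) c p =
    trans (homo-+ (λ e → c zero * p zero e) (λ e → sumFin k (λ i → c (suc i) * p (suc i) e)))
          (cong₂ _+_ (homo-* (c zero) (p zero)) (homo-sumFin k (λ i → c (suc i)) (λ i → p (suc i))))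

  homo-convex : (L : List (ℚ × (Fin m → Bool))) →
    f (λ e → sumList (λ { (w , δ) → w * incidence δ e }) L) ≡ sumList (λ { (w , δ) → w * f (incidence δ) }) L
  homo-convex []            = homo-0
  homo-convex ((w , δ) ∷ L) =
    trans (homo-+ (λ e → w * incidence δ e) (λ e → sumList (λ { (w , δ) → w * incidence δ e }) L))
          (cong₂ _+_ (homo-* w (incidence δ)) (homo-convex L))

  homo-combination≡0 : ∀ k (c : Fin k → ℚ) (p : Fin k → Vecℚ m) →
    (∀ e → sumFin k (λ i → c i * p i e) ≡ 0ℚ) → sumFin k (λ i → c i * f (p i)) ≡ 0ℚ
  homo-combination≡0 k c p c·p≡0 = trans (sym (homo-sumFin k c p)) (trans (resp-≗ c·p≡0) homo-0)

open IsLinear public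

module _ {m} {f g : Vecℚ m → ℚ} (f-lin : IsLinear f) (g-lin : IsLinear g) where

  IsLinear-difference : IsLinear (λ x → f x - g x)
  IsLinear-difference = record
    { resp-≗ = λ x≗y → cong₂ _-_ (resp-≗ f-lin x≗y) (resp-≗ g-lin x≗y)
    ; homo-0 = trans (cong₂ _-_ (homo-0 f-lin) (homo-0 g-lin)) (+-inverseʳ 0ℚ)
    ; homo-+ = λ x y → trans (cong₂ _-_ (homo-+ f-lin x y) (homo-+ g-lin x y))
        (solve 4 (λ a b c d → (a :+ b) :- (c :+ d) := (a :- c) :+ (b :- d)) refl (f x) (f y) (g x) (g y))
    ; homo-* = λ a x → trans (cong₂ _-_ (homo-* f-lin a x) (homo-* g-lin a x))
        (solve 3 (λ a b c → a :* b :- a :* c := a :* (b :- c)) refl a (f x) (g x))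
    }

IsLinear-combination : ∀ {m} k (c : Fin k → ℚ) {f : Fin k → Vecℚ m → ℚ} → (∀ j → IsLinear (f j)) →
  IsLinear (λ x → sumFin k (λ j → c j * f j x))
IsLinear-combination k c {f} lin = record
  { resp-≗ = λ x≗y → sumFin-cong k (λ j → cong (c j *_) (resp-≗ (lin j) x≗y))
  ; homo-0 = sumFin-zero k (λ j → trans (cong (c j *_) (homo-0 (lin j))) (*-zeroʳ (c j)))
  ; homo-+ = λ x y → trans (sumFin-cong k (λ j → trans (cong (c j *_) (homo-+ (lin j) x y)) (*-distribˡ-+ (c j) _ _)))
                           (sumFin-+ k (λ j → c j * f j x) (λ j → c j * f j y))
  ; homo-* = λ a x → trans (sumFin-cong k (λ j → trans (cong (c j *_) (homo-* (lin j) a x))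
                                  (solve 3 (λ c a v → c :* (a :* v) := a :* (c :* v)) refl (c j) a (f j x))))
                           (sumFin-*ˡ k a (λ j → c j * f j x))
  }

¬AffinelyIndependent-onHyperplane : ∀ m {f : Vecℚ m → ℚ} → IsLinear f → ∀ b → b ≢ 0ℚ →
  (p : Fin (suc m) → Vecℚ m) → (∀ i → f (p i) ≡ b) → ¬ AffinelyIndependent (suc m) p
¬AffinelyIndependent-onHyperplane m {f} lin b b≢0 p fp≡b affInd with linearlyDependent m p
... | c , (i , cᵢ≢0) , c·p≡0 = cᵢ≢0 (affInd c (x*y≡0⇒x≡0 _ b b≢0 Σc*b≡0) c·p≡0 i)
  where
  open ≡-Reasoning
  Σc*b≡0 : sumFin (suc m) c * b ≡ 0ℚ
  Σc*b≡0 = begin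
    sumFin (suc m) c * b                            ≡⟨ sym (sumFin-*ʳ (suc m) b c) ⟩
    sumFin (suc m) (λ j → c j * b)                  ≡⟨ sumFin-cong (suc m) (λ j → cong (c j *_) (sym (fp≡b j))) ⟩
    sumFin (suc m) (λ j → c j * f (p j))            ≡⟨ sym (homo-sumFin lin (suc m) c p) ⟩
    f (λ e → sumFin (suc m) (λ j → c j * p j e))    ≡⟨ resp-≗ lin c·p≡0 ⟩
    f (λ _ → 0ℚ)                                    ≡⟨ homo-0 lin ⟩
    0ℚ                                              ∎

triangular-kernel : ∀ {k} (λs : Fin k → ℚ) (A : Fin k → Fin k → ℚ) (rank : Fin k → ℕ) →
  (∀ i → sumFin k (λ j → λs j * A i j) ≡ 0ℚ) → (∀ i → A i i ≢ 0ℚ) →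
  (∀ i j → j ≢ i → rank i ≤ rank j → A i j ≡ 0ℚ) → ∀ i → λs i ≡ 0ℚ
triangular-kernel {zero}  λs A rank kernel diag upper ()
triangular-kernel {suc k} λs A rank kernel diag upper i = below (suc (rank i)) i ℕ.≤-refl
  where
  below : ∀ r i → rank i < r → λs i ≡ 0ℚ
  below (suc r) i rankᵢ<r =
    x*y≡0⇒x≡0 (λs i) (A i i) (diag i) (trans (sym (sumFin-single k (λ j → λs j * A i j) i others)) (kernel i))
    where
    others : ∀ j → j ≢ i → λs j * A i j ≡ 0ℚ
    others j j≢i with rank j ℕ.<? rank i
    ... | yes rankⱼ<rankᵢ = trans (cong (_* A i j) (below r j (ℕ.<-≤-trans rankⱼ<rankᵢ (ℕ.m<1+n⇒m≤n rankᵢ<r))))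
                                  (*-zeroˡ (A i j))
    ... | no  rankⱼ≮rankᵢ = trans (cong (λs j *_) (upper i j j≢i (ℕ.≮⇒≥ rankⱼ≮rankᵢ))) (*-zeroʳ (λs j))

affinelyIndependent-∷ : ∀ {m k} {f : Vecℚ m → ℚ} → IsLinear f → ∀ b (q : Vecℚ m) (p : Fin k → Vecℚ m) →
  f q ≢ b → (∀ j → f (p j) ≡ b) → AffinelyIndependent k p → AffinelyIndependent (suc k) (q ∷ᵥ p)
affinelyIndependent-∷ {m} {k} {f} lin b q p fq≢b fp≡b affInd λs Σλ≡0 λs·v≡0 = λs≡0
  where
  open ≡-Reasoning
  λ₀ = λs zero
  rest = λ j → λs (suc j)
  Σrest≡-λ₀ : sumFin k rest ≡ - λ₀
  Σrest≡-λ₀ = trans (solve 2 (λ a s → s := (a :+ s) :- a) refl λ₀ (sumFin k rest))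
                    (trans (cong (_- λ₀) Σλ≡0) (+-identityˡ (- λ₀)))
  λ₀*[fq-b]≡0 : λ₀ * (f q - b) ≡ 0ℚ
  λ₀*[fq-b]≡0 = begin
    λ₀ * (f q - b)                                  ≡⟨ solve 3 (λ l x c → l :* (x :- c) := l :* x :+ (:- l) :* c) refl λ₀ (f q) b ⟩
    λ₀ * f q + (- λ₀) * b                           ≡⟨ cong (λ s → λ₀ * f q + s * b) (sym Σrest≡-λ₀) ⟩
    λ₀ * f q + sumFin k rest * b                    ≡⟨ cong (λ₀ * f q +_) (sym (sumFin-*ʳ k b rest)) ⟩
    λ₀ * f q + sumFin k (λ j → rest j * b)          ≡⟨ cong (λ₀ * f q +_) (sumFin-cong k (λ j → cong (rest j *_) (sym (fp≡b j)))) ⟩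
    sumFin (suc k) (λ i → λs i * f ((q ∷ᵥ p) i))     ≡⟨ homo-combination≡0 lin (suc k) λs (q ∷ᵥ p) λs·v≡0 ⟩
    0ℚ                                              ∎
  λ₀≡0 : λ₀ ≡ 0ℚ
  λ₀≡0 = x*y≡0⇒x≡0 λ₀ (f q - b) (λ fq-b≡0 → fq≢b (trans (solve 2 (λ x c → x := (x :- c) :+ c) refl (f q) b)
                                                        (trans (cong (_+ b) fq-b≡0) (+-identityˡ b))))
                   λ₀*[fq-b]≡0
  rest≡0 : ∀ j → rest j ≡ 0ℚ
  rest≡0 = affInd rest (trans Σrest≡-λ₀ (cong -_ λ₀≡0)) (λ e →
    trans (sym (+-identityˡ _)) (trans (cong (_+ sumFin k (λ j → rest j * p j e)) (sym (trans (cong (_* q e) λ₀≡0) (*-zeroˡ (q e)))))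
                                       (λs·v≡0 e)))
  λs≡0 : ∀ i → λs i ≡ 0ℚ
  λs≡0 zero    = λ₀≡0
  λs≡0 (suc j) = rest≡0 j

sumFrom-congᵢ : ∀ a k {f g : ℕ → ℚ} → (∀ i → a ≤ i → i < a ℕ.+ k → f i ≡ g i) →
  sumFrom a k f ≡ sumFrom a k g
sumFrom-congᵢ a zero    f≗g = refl
sumFrom-congᵢ a (suc k) f≗g =
  cong₂ _+_ (f≗g a ℕ.≤-refl (ℕ.m<m+n a (s≤s z≤n)))
            (sumFrom-congᵢ (suc a) k (λ i a<i i<a+1+k →
                f≗g i (ℕ.<⇒≤ a<i) (subst (i <_) (sym (ℕ.+-suc a k)) i<a+1+k)))

sumFrom-cong : ∀ a k {f g : ℕ → ℚ} → (∀ i → f i ≡ g i) → sumFrom a k f ≡ sumFrom a k g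
sumFrom-cong a k f≗g = sumFrom-congᵢ a k (λ i _ _ → f≗g i)

sumFrom-++ : ∀ a k₁ k₂ (f : ℕ → ℚ) → sumFrom a (k₁ ℕ.+ k₂) f ≡ sumFrom a k₁ f + sumFrom (a ℕ.+ k₁) k₂ f
sumFrom-++ a zero     k₂ f = sym (trans (+-identityˡ _) (cong (λ b → sumFrom b k₂ f) (ℕ.+-identityʳ a)))
sumFrom-++ a (suc k₁) k₂ f =
  trans (cong (f a +_) (sumFrom-++ (suc a) k₁ k₂ f))
        (trans (sym (+-assoc (f a) _ _))
               (cong (λ b → (f a + sumFrom (suc a) k₁ f) + sumFrom b k₂ f) (sym (ℕ.+-suc a k₁))))

sumRange-++ : ∀ x y z (f : ℕ → ℚ) → x ≤ y → y ≤ z → sumRange x y f + sumRange y z f ≡ sumRange x z f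
sumRange-++ x y z f x≤y y≤z = begin
    sumFrom x (y ∸ x) f + sumFrom y (z ∸ y) f
  ≡⟨ cong (λ b → sumFrom x (y ∸ x) f + sumFrom b (z ∸ y) f) (sym (ℕ.m+[n∸m]≡n x≤y)) ⟩
    sumFrom x (y ∸ x) f + sumFrom (x ℕ.+ (y ∸ x)) (z ∸ y) f
  ≡⟨ sym (sumFrom-++ x (y ∸ x) (z ∸ y) f) ⟩
    sumFrom x ((y ∸ x) ℕ.+ (z ∸ y)) f
  ≡⟨ cong (λ k → sumFrom x k f) lengths ⟩
    sumFrom x (z ∸ x) f ∎
  where
  open ≡-Reasoning
  lengths : (y ∸ x) ℕ.+ (z ∸ y) ≡ z ∸ x
  lengths = trans (ℕ.+-comm (y ∸ x) (z ∸ y))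
            (trans (sym (ℕ.+-∸-assoc (z ∸ y) x≤y)) (cong (_∸ x) (ℕ.m∸n+n≡m y≤z)))

sumFrom-zero : ∀ a k {f : ℕ → ℚ} → (∀ i → f i ≡ 0ℚ) → sumFrom a k f ≡ 0ℚ
sumFrom-zero a zero    f≗0 = refl
sumFrom-zero a (suc k) f≗0 = cong₂ _+_ (f≗0 a) (sumFrom-zero (suc a) k f≗0)

sumFrom-+ : ∀ a k (f g : ℕ → ℚ) → sumFrom a k (λ i → f i + g i) ≡ sumFrom a k f + sumFrom a k g
sumFrom-+ a zero    f g = refl
sumFrom-+ a (suc k) f g =
  trans (cong ((f a + g a) +_) (sumFrom-+ (suc a) k f g))
        (solve 4 (λ p q r s → (p :+ q) :+ (r :+ s) := (p :+ r) :+ (q :+ s)) refl (f a) (g a) _ _)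

sumFrom-*ˡ : ∀ a k c (f : ℕ → ℚ) → sumFrom a k (λ i → c * f i) ≡ c * sumFrom a k f
sumFrom-*ˡ a zero    c f = sym (*-zeroʳ c)
sumFrom-*ˡ a (suc k) c f = trans (cong (c * f a +_) (sumFrom-*ˡ (suc a) k c f)) (sym (*-distribˡ-+ c (f a) _))

sumFrom-mono-≤ : ∀ a k {f g : ℕ → ℚ} → (∀ i → f i ≤ℚ g i) → sumFrom a k f ≤ℚ sumFrom a k g
sumFrom-mono-≤ a zero    f≤g = ≤-refl
sumFrom-mono-≤ a (suc k) f≤g = +-mono-≤ (f≤g a) (sumFrom-mono-≤ (suc a) k f≤g)

-- By recursion rather than via ℚof, so that ι k computes for closed k.
ι : ℕ → ℚ
ι zero    = 0ℚ
ι (suc k) = 1ℚ + ι k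

ι-+ : ∀ a b → ι (a ℕ.+ b) ≡ ι a + ι b
ι-+ zero    b = sym (+-identityˡ _)
ι-+ (suc a) b = trans (cong (1ℚ +_) (ι-+ a b)) (sym (+-assoc 1ℚ (ι a) (ι b)))

ι-* : ∀ a b → ι (a ℕ.* b) ≡ ι a * ι b
ι-* zero    b = sym (*-zeroˡ (ι b))
ι-* (suc a) b = trans (ι-+ b (a ℕ.* b)) (trans (cong (ι b +_) (ι-* a b))
  (sym (trans (*-distribʳ-+ (ι b) 1ℚ (ι a)) (cong (_+ ι a * ι b) (*-identityˡ (ι b))))))

ι-mono-≤ : ∀ {a b} → a ≤ b → ι a ≤ℚ ι b
ι-mono-≤ {b = zero}  z≤n       = ≤-refl
ι-mono-≤ {b = suc b} z≤n       = +-mono-≤ (<⇒≤ (positive⁻¹ 1ℚ)) (ι-mono-≤ {b = b} z≤n)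
ι-mono-≤             (s≤s a≤b) = +-monoʳ-≤ 1ℚ (ι-mono-≤ a≤b)

ι-mono-< : ∀ {a b} → a < b → ι a <ℚ ι b
ι-mono-< {a} {suc b} a<1+b = ≤-<-trans (ι-mono-≤ (ℕ.m<1+n⇒m≤n a<1+b))
  (subst (_<ℚ 1ℚ + ι b) (+-identityˡ (ι b)) (+-monoˡ-< (ι b) {0ℚ} {1ℚ} (positive⁻¹ 1ℚ)))

*-monoʳ-≤-ι : ∀ k {u v} → u ≤ℚ v → ι k * u ≤ℚ ι k * v
*-monoʳ-≤-ι k = *-monoˡ-≤-nonNeg (ι k) {{nonNegative (ι-mono-≤ {0} {k} z≤n)}}

sumℕ : ℕ → ℕ → (ℕ → ℕ) → ℕ
sumℕ a zero    f = 0
sumℕ a (suc k) f = f a ℕ.+ sumℕ (suc a) k f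

ι-sumℕ : ∀ a k (f : ℕ → ℕ) → ι (sumℕ a k f) ≡ sumFrom a k (λ i → ι (f i))
ι-sumℕ a zero    f = refl
ι-sumℕ a (suc k) f = trans (ι-+ (f a) _) (cong (ι (f a) +_) (ι-sumℕ (suc a) k f))

sumℕ-++ : ∀ a k₁ k₂ (f : ℕ → ℕ) → sumℕ a (k₁ ℕ.+ k₂) f ≡ sumℕ a k₁ f ℕ.+ sumℕ (a ℕ.+ k₁) k₂ f
sumℕ-++ a zero     k₂ f = cong (λ b → sumℕ b k₂ f) (sym (ℕ.+-identityʳ a))
sumℕ-++ a (suc k₁) k₂ f =
  trans (cong (f a ℕ.+_) (sumℕ-++ (suc a) k₁ k₂ f))
        (trans (sym (ℕ.+-assoc (f a) _ _))
               (cong (λ b → (f a ℕ.+ sumℕ (suc a) k₁ f) ℕ.+ sumℕ b k₂ f) (sym (ℕ.+-suc a k₁))))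

sumℕ-congᵢ : ∀ a k {f g : ℕ → ℕ} → (∀ i → a ≤ i → i < a ℕ.+ k → f i ≡ g i) → sumℕ a k f ≡ sumℕ a k g
sumℕ-congᵢ a zero    f≗g = refl
sumℕ-congᵢ a (suc k) f≗g =
  cong₂ ℕ._+_ (f≗g a ℕ.≤-refl (ℕ.m<m+n a (s≤s z≤n)))
              (sumℕ-congᵢ (suc a) k (λ i a<i i<a+1+k →
                f≗g i (ℕ.<⇒≤ a<i) (subst (i <_) (sym (ℕ.+-suc a k)) i<a+1+k)))

sumℕ-shift : ∀ a s k (f : ℕ → ℕ) → sumℕ (a ℕ.+ s) k f ≡ sumℕ a k (λ i → f (i ℕ.+ s))
sumℕ-shift a s zero    f = refl
sumℕ-shift a s (suc k) f = cong (f (a ℕ.+ s) ℕ.+_) (sumℕ-shift (suc a) s k f)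

sumℕ-+ : ∀ a k (f g : ℕ → ℕ) → sumℕ a k (λ i → f i ℕ.+ g i) ≡ sumℕ a k f ℕ.+ sumℕ a k g
sumℕ-+ a zero    f g = refl
sumℕ-+ a (suc k) f g =
  trans (cong ((f a ℕ.+ g a) ℕ.+_) (sumℕ-+ (suc a) k f g))
        (+-interchange (f a) (g a) (sumℕ (suc a) k f) (sumℕ (suc a) k g))

sumℕ-mono-≤ : ∀ a k {f g : ℕ → ℕ} → (∀ i → f i ≤ g i) → sumℕ a k f ≤ sumℕ a k g
sumℕ-mono-≤ a zero    f≤g = z≤n
sumℕ-mono-≤ a (suc k) f≤g = ℕ.+-mono-≤ (f≤g a) (sumℕ-mono-≤ (suc a) k f≤g)

term≤sumℕ : ∀ a k (f : ℕ → ℕ) i → a ≤ i → i < a ℕ.+ k → f i ≤ sumℕ a k f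
term≤sumℕ a zero    f i a≤i i<a+0 = ⊥-elim (ℕ.<⇒≱ i<a+0 (subst (_≤ i) (sym (ℕ.+-identityʳ a)) a≤i))
term≤sumℕ a (suc k) f i a≤i i<a+1+k with ℕ.m≤n⇒m<n∨m≡n a≤i
... | inj₂ refl = ℕ.m≤m+n (f a) _
... | inj₁ a<i  = ℕ.≤-trans (term≤sumℕ (suc a) k f i a<i (subst (i <_) (ℕ.+-suc a k) i<a+1+k)) (ℕ.m≤n+m _ (f a))

sumℕ-single : ∀ a k (f : ℕ → ℕ) z → a ≤ z → z < a ℕ.+ k →
  (∀ i → a ≤ i → i < a ℕ.+ k → i ≢ z → f i ≡ 0) → sumℕ a k f ≡ f z
sumℕ-single a zero    f z a≤z z<a+0 _ = ⊥-elim (ℕ.<⇒≱ z<a+0 (subst (_≤ z) (sym (ℕ.+-identityʳ a)) a≤z))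
sumℕ-single a (suc k) f z a≤z z<a+1+k others≡0 with a ℕ.≟ z
... | yes refl = trans (cong (f a ℕ.+_) (trans (sumℕ-congᵢ (suc a) k others≡0′) (sumℕ-zero (suc a) k))) (ℕ.+-identityʳ (f a))
  where
  others≡0′ : ∀ i → suc a ≤ i → i < suc a ℕ.+ k → f i ≡ 0
  others≡0′ i a<i i<a+1+k = others≡0 i (ℕ.<⇒≤ a<i) (subst (i <_) (sym (ℕ.+-suc a k)) i<a+1+k) (ℕ.<⇒≢ a<i ∘ sym)
  sumℕ-zero : ∀ b m → sumℕ b m (λ _ → 0) ≡ 0
  sumℕ-zero b zero    = refl
  sumℕ-zero b (suc m) = sumℕ-zero (suc b) m
... | no a≢z = trans (cong (ℕ._+ sumℕ (suc a) k f) (others≡0 a ℕ.≤-refl (ℕ.m<m+n a (s≤s z≤n)) a≢z))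
  (sumℕ-single (suc a) k f z (ℕ.≤∧≢⇒< a≤z a≢z) (subst (z <_) (ℕ.+-suc a k) z<a+1+k)
    (λ i a<i i<a+1+k → others≡0 i (ℕ.<⇒≤ a<i) (subst (i <_) (sym (ℕ.+-suc a k)) i<a+1+k)))

module _ {m : ℕ} where

  coord-+ : ∀ (x y : Vecℚ m) i → coord (λ e → x e + y e) i ≡ coord x i + coord y i
  coord-+ x y i with i ℕ.<? m
  ... | yes _ = refl
  ... | no  _ = refl

  coord-* : ∀ a (x : Vecℚ m) i → coord (λ e → a * x e) i ≡ a * coord x i
  coord-* a x i with i ℕ.<? m
  ... | yes _ = refl
  ... | no  _ = sym (*-zeroʳ a)

  coord-0 : ∀ i → coord {m} (λ _ → 0ℚ) i ≡ 0ℚ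
  coord-0 i with i ℕ.<? m
  ... | yes _ = refl
  ... | no  _ = refl

  coord-≗ : ∀ {x y : Vecℚ m} → x ≗ y → ∀ i → coord x i ≡ coord y i
  coord-≗ x≗y i with i ℕ.<? m
  ... | yes _ = x≗y _
  ... | no  _ = refl

  coord-mono-≤ : ∀ {x y : Vecℚ m} → (∀ e → x e ≤ℚ y e) → ∀ i → coord x i ≤ℚ coord y i
  coord-mono-≤ x≤y i with i ℕ.<? m
  ... | yes _ = x≤y _
  ... | no  _ = ≤-refl

  coord-linear : ∀ i → IsLinear (λ (x : Vecℚ m) → coord x i)
  coord-linear i = record
    { resp-≗ = λ x≗y → coord-≗ x≗y i ; homo-0 = coord-0 i ; homo-+ = λ x y → coord-+ x y i ; homo-* = λ a x → coord-* a x i }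

  IsLinear-≗ : ∀ {f g : Vecℚ m → ℚ} → (∀ x → f x ≡ g x) → IsLinear g → IsLinear f
  IsLinear-≗ {f} {g} f≗g lin = record
    { resp-≗ = λ x≗y → trans (f≗g _) (trans (resp-≗ lin x≗y) (sym (f≗g _)))
    ; homo-0 = trans (f≗g _) (homo-0 lin)
    ; homo-+ = λ x y → trans (f≗g _) (trans (homo-+ lin x y) (sym (cong₂ _+_ (f≗g x) (f≗g y))))
    ; homo-* = λ a x → trans (f≗g _) (trans (homo-* lin a x) (sym (cong (a *_) (f≗g x))))
    }

-- The cycle inequality

record Parameters : Set where
  field
    n N₀ β       : ℕ
    ℓ            : ℕ → ℕ
    5≤n          : 5 ≤ n
    n≤N          : n ≤ suc N₀
    ℓ0≡0         : ℓ 0 ≡ 0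
    ℓ-increasing : ∀ j → j < n → ℓ j < ℓ (suc j)
    ℓn≡N         : ℓ n ≡ suc N₀
    β∈12         : β ≡ 1 ⊎ β ≡ 2

module CycleFacet (P : Parameters) where

  open Parameters P

  N : ℕ
  N = suc N₀

  M : ℕ
  M = 2 ℕ.* N

  M≡N+N : M ≡ N ℕ.+ N
  M≡N+N = cong (N ℕ.+_) (ℕ.+-identityʳ N)

  ℓ-mono-≤ : ∀ {a b} → a ≤ b → b ≤ n → ℓ a ≤ ℓ b
  ℓ-mono-≤ a≤b = go (ℕ.≤⇒≤′ a≤b)
    where
    go : ∀ {a b} → a ℕ.≤′ b → b ≤ n → ℓ a ≤ ℓ b
    go ℕ.≤′-refl          _     = ℕ.≤-refl
    go (ℕ.≤′-step a≤′b) 1+b≤n = ℕ.≤-trans (go a≤′b (ℕ.<⇒≤ 1+b≤n)) (ℕ.<⇒≤ (ℓ-increasing _ 1+b≤n))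

  ℓ-mono-< : ∀ {a b} → a < b → b ≤ n → ℓ a < ℓ b
  ℓ-mono-< {b = suc b} (s≤s a≤b) 1+b≤n = ℕ.≤-<-trans (ℓ-mono-≤ a≤b (ℕ.<⇒≤ 1+b≤n)) (ℓ-increasing b 1+b≤n)

  record InBlock (i J : ℕ) : Set where
    field
      1≤J   : 1 ≤ J
      J≤n   : J ≤ n
      lower : ℓ (J ∸ 1) ≤ i
      upper : i < ℓ J

  blockFrom : ℕ → ℕ → ℕ → ℕ
  blockFrom i j zero    = j
  blockFrom i j (suc f) with i ℕ.<? ℓ j
  ... | yes _ = j
  ... | no  _ = blockFrom i (suc j) f

  block : ℕ → ℕ
  block i = blockFrom i 1 (n ∸ 1)

  1+[n∸1]≡n : 1 ℕ.+ (n ∸ 1) ≡ n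
  1+[n∸1]≡n = ℕ.m+[n∸m]≡n (ℕ.≤-trans (s≤s z≤n) 5≤n)

  blockFrom-unique : ∀ i J f j → j ≤ J → J ≤ j ℕ.+ f → (∀ j′ → j ≤ j′ → j′ < J → ℓ j′ ≤ i) → i < ℓ J →
    blockFrom i j f ≡ J
  blockFrom-unique i J zero    j j≤J J≤j+0 below i<ℓJ = ℕ.≤-antisym j≤J (subst (J ≤_) (ℕ.+-identityʳ j) J≤j+0)
  blockFrom-unique i J (suc f) j j≤J J≤j+1+f below i<ℓJ with i ℕ.<? ℓ j | ℕ.m≤n⇒m<n∨m≡n j≤J
  ... | yes i<ℓj | inj₁ j<J  = ⊥-elim (ℕ.<⇒≱ i<ℓj (below j ℕ.≤-refl j<J))
  ... | yes _    | inj₂ j≡J  = j≡J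
  ... | no  i≮ℓj | inj₂ refl = ⊥-elim (i≮ℓj i<ℓJ)
  ... | no  _    | inj₁ j<J  = blockFrom-unique i J f (suc j) j<J (subst (J ≤_) (ℕ.+-suc j f) J≤j+1+f)
                                 (λ j′ j<j′ j′<J → below j′ (ℕ.<⇒≤ j<j′) j′<J) i<ℓJ

  block-unique : ∀ {i J} → InBlock i J → block i ≡ J
  block-unique {i} {J} inJ = blockFrom-unique i J (n ∸ 1) 1 1≤J (subst (J ≤_) (sym 1+[n∸1]≡n) J≤n)
    (λ j′ _ j′<J → ℕ.≤-trans (ℓ-mono-≤ (ℕ.<⇒≤pred j′<J) (ℕ.≤-trans (ℕ.m∸n≤m J 1) J≤n)) lower) upper
    where open InBlock inJ

  blockFrom-inBlock : ∀ i f j → 1 ≤ j → j ℕ.+ f ≤ n → ℓ (j ∸ 1) ≤ i → i < ℓ (j ℕ.+ f) →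
    InBlock i (blockFrom i j f)
  blockFrom-inBlock i zero    j 1≤j j+0≤n lower upper =
    record { 1≤J = 1≤j ; J≤n = subst (_≤ n) (ℕ.+-identityʳ j) j+0≤n ; lower = lower
           ; upper = subst (λ k → i < ℓ k) (ℕ.+-identityʳ j) upper }
  blockFrom-inBlock i (suc f) j 1≤j j+1+f≤n lower upper with i ℕ.<? ℓ j
  ... | yes i<ℓj = record { 1≤J = 1≤j ; J≤n = ℕ.≤-trans (ℕ.m≤m+n j (suc f)) j+1+f≤n ; lower = lower ; upper = i<ℓj }
  ... | no  i≮ℓj = blockFrom-inBlock i f (suc j) (s≤s z≤n) (subst (_≤ n) (ℕ.+-suc j f) j+1+f≤n) (ℕ.≮⇒≥ i≮ℓj)
                     (subst (λ k → i < ℓ k) (ℕ.+-suc j f) upper)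

  block-inBlock : ∀ {i} → i < N → InBlock i (block i)
  block-inBlock {i} i<N = blockFrom-inBlock i (n ∸ 1) 1 (s≤s z≤n) (ℕ.≤-reflexive 1+[n∸1]≡n)
    (subst (_≤ i) (sym ℓ0≡0) z≤n) (subst (λ k → i < ℓ k) (sym 1+[n∸1]≡n) (subst (i <_) (sym ℓn≡N) i<N))

  blockTerm : ℕ → Vecℚ M → ℕ → ℚ
  blockTerm j x i = ℚof (betaJ β j) * coord x i + ℚof (betaJ' β j) * coord x (i ℕ.+ N)

  sumBlocks≡sumRange : ∀ x k a → a ℕ.+ k ≤ n →
    sumFrom (suc a) k (λ j → sumRange (ℓ (j ∸ 1)) (ℓ j) (blockTerm j x))
      ≡ sumRange (ℓ a) (ℓ (a ℕ.+ k)) (λ i → blockTerm (block i) x i)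
  sumBlocks≡sumRange x zero    a _ = sym (cong (λ k → sumFrom (ℓ a) k (λ i → blockTerm (block i) x i))
    (trans (cong (λ b → ℓ b ∸ ℓ a) (ℕ.+-identityʳ a)) (ℕ.n∸n≡0 (ℓ a))))
  sumBlocks≡sumRange x (suc k) a a+1+k≤n = begin
      sumRange (ℓ a) (ℓ (suc a)) (blockTerm (suc a) x) + sumFrom (suc (suc a)) k _
    ≡⟨ cong₂ _+_ (sumFrom-congᵢ (ℓ a) (ℓ (suc a) ∸ ℓ a) inBlock) (sumBlocks≡sumRange x k (suc a) 1+a+k≤n) ⟩
      sumRange (ℓ a) (ℓ (suc a)) h + sumRange (ℓ (suc a)) (ℓ (suc a ℕ.+ k)) h
    ≡⟨ sumRange-++ (ℓ a) (ℓ (suc a)) (ℓ (suc a ℕ.+ k)) h (ℕ.<⇒≤ (ℓ-increasing a a<n)) (ℓ-mono-≤ (ℕ.m≤m+n (suc a) k) 1+a+k≤n) ⟩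
      sumRange (ℓ a) (ℓ (suc a ℕ.+ k)) h
    ≡⟨ cong (λ b → sumRange (ℓ a) (ℓ b) h) (sym (ℕ.+-suc a k)) ⟩
      sumRange (ℓ a) (ℓ (a ℕ.+ suc k)) h ∎
    where
    open ≡-Reasoning
    h = λ i → blockTerm (block i) x i
    1+a+k≤n : suc a ℕ.+ k ≤ n
    1+a+k≤n = subst (_≤ n) (ℕ.+-suc a k) a+1+k≤n
    a<n : a < n
    a<n = ℕ.≤-trans (s≤s (ℕ.m≤m+n a k)) 1+a+k≤n
    inBlock : ∀ i → ℓ a ≤ i → i < ℓ a ℕ.+ (ℓ (suc a) ∸ ℓ a) → blockTerm (suc a) x i ≡ h i
    inBlock i lower upper = cong (λ j → blockTerm j x i) (sym (block-unique record
      { 1≤J = s≤s z≤n ; J≤n = ℕ.≤-trans (s≤s (ℕ.m≤m+n a k)) 1+a+k≤n ; lower = lower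
      ; upper = subst (i <_) (ℕ.m+[n∸m]≡n (ℕ.<⇒≤ (ℓ-increasing a a<n))) upper }))

  cycleLHS≡sumBlockTerms : ∀ x → cycleLHS n N ℓ β x ≡ sumFrom 0 N (λ i → blockTerm (block i) x i)
  cycleLHS≡sumBlockTerms x = trans (sumBlocks≡sumRange x n 0 ℕ.≤-refl)
    (cong₂ (λ u v → sumRange u v (λ i → blockTerm (block i) x i)) ℓ0≡0 ℓn≡N)

  betaJ-values : ∀ j → (betaJ β j ≡ 1 × betaJ' β j ≡ 2) ⊎ (betaJ β j ≡ 2 × betaJ' β j ≡ 1)
  betaJ-values j = go j β∈12
    where
    go : ∀ j → β ≡ 1 ⊎ β ≡ 2 → (betaJ β j ≡ 1 × betaJ' β j ≡ 2) ⊎ (betaJ β j ≡ 2 × betaJ' β j ≡ 1)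
    go zero                (inj₁ refl) = inj₂ (refl , refl)
    go zero                (inj₂ refl) = inj₁ (refl , refl)
    go (suc zero)          (inj₁ refl) = inj₁ (refl , refl)
    go (suc zero)          (inj₂ refl) = inj₂ (refl , refl)
    go (suc (suc j))       β12         = go j β12

  α α′ : ℕ → ℕ
  α  i = betaJ  β (block i)
  α′ i = betaJ' β (block i)

  α-values : ∀ i → (α i ≡ 1 × α′ i ≡ 2) ⊎ (α i ≡ 2 × α′ i ≡ 1)
  α-values i = betaJ-values (block i)

  α∈12 : ∀ i → α i ≡ 1 ⊎ α i ≡ 2
  α∈12 i with α-values i
  ... | inj₁ (α≡1 , _) = inj₁ α≡1
  ... | inj₂ (α≡2 , _) = inj₂ α≡2

  α′∈12 : ∀ i → α′ i ≡ 1 ⊎ α′ i ≡ 2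
  α′∈12 i with α-values i
  ... | inj₁ (_ , α′≡2) = inj₂ α′≡2
  ... | inj₂ (_ , α′≡1) = inj₁ α′≡1

  α+α′≡3 : ∀ i → α i ℕ.+ α′ i ≡ 3
  α+α′≡3 i with α-values i
  ... | inj₁ (α≡1 , α′≡2) = cong₂ ℕ._+_ α≡1 α′≡2
  ... | inj₂ (α≡2 , α′≡1) = cong₂ ℕ._+_ α≡2 α′≡1

  ℚof≡ι : ∀ {k} → k ≡ 1 ⊎ k ≡ 2 → ℚof k ≡ ι k
  ℚof≡ι (inj₁ refl) = refl
  ℚof≡ι (inj₂ refl) = refl

  lhsTerm : Vecℚ M → ℕ → ℚ
  lhsTerm x i = ι (α i) * coord x i + ι (α′ i) * coord x (i ℕ.+ N)

  lhs : Vecℚ M → ℚ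
  lhs x = sumFrom 0 N (lhsTerm x)

  cycleLHS≡lhs : ∀ x → cycleLHS n N ℓ β x ≡ lhs x
  cycleLHS≡lhs x = trans (cycleLHS≡sumBlockTerms x) (sumFrom-cong 0 N (λ i →
    cong₂ (λ u v → u * coord x i + v * coord x (i ℕ.+ N)) (ℚof≡ι (α∈12 i)) (ℚof≡ι (α′∈12 i))))

  lhs-linear : IsLinear lhs
  lhs-linear = record
    { resp-≗ = λ x≗y → sumFrom-cong 0 N (λ i → cong₂ (λ u v → ι (α i) * u + ι (α′ i) * v)
                          (coord-≗ x≗y i) (coord-≗ x≗y (i ℕ.+ N)))
    ; homo-0 = sumFrom-zero 0 N (λ i → trans (cong₂ (λ u v → ι (α i) * u + ι (α′ i) * v) (coord-0 {M} i) (coord-0 {M} (i ℕ.+ N)))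
                                       (cong₂ _+_ (*-zeroʳ (ι (α i))) (*-zeroʳ (ι (α′ i)))))
    ; homo-+ = λ x y → trans (sumFrom-cong 0 N (λ i → trans
                   (cong₂ (λ u v → ι (α i) * u + ι (α′ i) * v) (coord-+ x y i) (coord-+ x y (i ℕ.+ N)))
                   (solve 6 (λ a b p q r s → a :* (p :+ q) :+ b :* (r :+ s) := (a :* p :+ b :* r) :+ (a :* q :+ b :* s))
                     refl (ι (α i)) (ι (α′ i)) (coord x i) (coord y i) (coord x (i ℕ.+ N)) (coord y (i ℕ.+ N)))))
                 (sumFrom-+ 0 N (lhsTerm x) (lhsTerm y))
    ; homo-* = λ c x → trans (sumFrom-cong 0 N (λ i → trans
                   (cong₂ (λ u v → ι (α i) * u + ι (α′ i) * v) (coord-* c x i) (coord-* c x (i ℕ.+ N)))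
                   (solve 5 (λ a b c p r → a :* (c :* p) :+ b :* (c :* r) := c :* (a :* p :+ b :* r))
                     refl (ι (α i)) (ι (α′ i)) c (coord x i) (coord x (i ℕ.+ N)))))
                 (sumFrom-*ˡ 0 N c (lhsTerm x))
    }

  cycleLHS-linear : IsLinear (cycleLHS n N ℓ β)
  cycleLHS-linear = IsLinear-≗ cycleLHS≡lhs lhs-linear

  cycleLHS-mono-≤ : ∀ {x y} → (∀ e → x e ≤ℚ y e) → cycleLHS n N ℓ β x ≤ℚ cycleLHS n N ℓ β y
  cycleLHS-mono-≤ {x} {y} x≤y = subst₂ _≤ℚ_ (sym (cycleLHS≡lhs x)) (sym (cycleLHS≡lhs y))
    (sumFrom-mono-≤ 0 N {lhsTerm x} {lhsTerm y} (λ i → +-mono-≤ (*-monoʳ-≤-ι (α i) (coord-mono-≤ x≤y i))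
                                        (*-monoʳ-≤-ι (α′ i) (coord-mono-≤ x≤y (i ℕ.+ N)))))

  -- Validity

  CycleEdgeSet : Set
  CycleEdgeSet = EdgeSet (Cycle M)

  -- 1 if edge i is cut and 0 otherwise, including for i ≥ M.
  cut : CycleEdgeSet → ℕ → ℕ
  cut δ i with i ℕ.<? M
  ... | yes i<M = if δ (fromℕ< i<M) then 1 else 0
  ... | no  _   = 0

  coord-incidence : ∀ δ i → coord (incidence δ) i ≡ ι (cut δ i)
  coord-incidence δ i with i ℕ.<? M
  ... | no  _   = refl
  ... | yes i<M with δ (fromℕ< i<M)
  ...   | true  = refl
  ...   | false = refl

  cut∈01 : ∀ δ i → cut δ i ≡ 0 ⊎ cut δ i ≡ 1
  cut∈01 δ i with i ℕ.<? M
  ... | no  _   = inj₁ refl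
  ... | yes i<M with δ (fromℕ< i<M)
  ...   | true  = inj₂ refl
  ...   | false = inj₁ refl

  cut-toℕ : ∀ δ (e : Fin M) → cut δ (toℕ e) ≡ (if δ e then 1 else 0)
  cut-toℕ δ e with toℕ e ℕ.<? M
  ... | no  e≮M = ⊥-elim (e≮M (toℕ<n e))
  ... | yes e<M = cong (λ e′ → if δ e′ then 1 else 0) (toℕ-injective (toℕ-fromℕ< e<M))

  weightTerm : CycleEdgeSet → ℕ → ℕ
  weightTerm δ i = α i ℕ.* cut δ i ℕ.+ α′ i ℕ.* cut δ (i ℕ.+ N)

  weight : CycleEdgeSet → ℕ
  weight δ = sumℕ 0 N (weightTerm δ)

  cycleLHS-incidence : ∀ δ → cycleLHS n N ℓ β (incidence δ) ≡ ι (weight δ)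
  cycleLHS-incidence δ = trans (cycleLHS≡lhs (incidence δ)) (trans (sumFrom-cong 0 N (λ i → begin
      ι (α i) * coord (incidence δ) i + ι (α′ i) * coord (incidence δ) (i ℕ.+ N)
    ≡⟨ cong₂ (λ u v → ι (α i) * u + ι (α′ i) * v) (coord-incidence δ i) (coord-incidence δ (i ℕ.+ N)) ⟩
      ι (α i) * ι (cut δ i) + ι (α′ i) * ι (cut δ (i ℕ.+ N))
    ≡⟨ sym (cong₂ _+_ (ι-* (α i) (cut δ i)) (ι-* (α′ i) (cut δ (i ℕ.+ N)))) ⟩
      ι (α i ℕ.* cut δ i) + ι (α′ i ℕ.* cut δ (i ℕ.+ N))
    ≡⟨ sym (ι-+ (α i ℕ.* cut δ i) _) ⟩
      ι (weightTerm δ i) ∎))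
    (sym (ι-sumℕ 0 N (weightTerm δ))))
    where open ≡-Reasoning

  cutsBefore : CycleEdgeSet → ℕ → ℕ
  cutsBefore δ x = sumℕ 0 x (cut δ)

  totalCuts : CycleEdgeSet → ℕ
  totalCuts δ = cutsBefore δ M

  cutsBefore-suc : ∀ δ x → cutsBefore δ (suc x) ≡ cutsBefore δ x ℕ.+ cut δ x
  cutsBefore-suc δ x = trans (cong (λ k → sumℕ 0 k (cut δ)) (ℕ.+-comm 1 x))
    (trans (sumℕ-++ 0 x 1 (cut δ)) (cong (cutsBefore δ x ℕ.+_) (ℕ.+-identityʳ (cut δ x))))

  cutsBefore-mono-≤ : ∀ δ {a x} → a ≤ x → cutsBefore δ a ≤ cutsBefore δ x
  cutsBefore-mono-≤ δ a≤x = go (ℕ.≤⇒≤′ a≤x)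
    where
    go : ∀ {a x} → a ℕ.≤′ x → cutsBefore δ a ≤ cutsBefore δ x
    go ℕ.≤′-refl                = ℕ.≤-refl
    go {x = suc x} (ℕ.≤′-step a≤′x) =
      ℕ.≤-trans (go a≤′x) (subst (cutsBefore δ x ≤_) (sym (cutsBefore-suc δ x)) (ℕ.m≤m+n _ _))

  cutsBefore-cut : ∀ δ {a e x} → a ≤ e → e < x → cutsBefore δ a ℕ.+ cut δ e ≤ cutsBefore δ x
  cutsBefore-cut δ {a} {e} {x} a≤e e<x =
    ℕ.≤-trans (ℕ.+-monoˡ-≤ (cut δ e) (cutsBefore-mono-≤ δ a≤e))
              (subst (_≤ cutsBefore δ x) (cutsBefore-suc δ e) (cutsBefore-mono-≤ δ e<x))

  cutsBefore≤totalCuts : ∀ δ {x} → x ≤ M → cutsBefore δ x ≤ totalCuts δ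
  cutsBefore≤totalCuts δ = cutsBefore-mono-≤ δ

  noCutsBetween : ∀ δ {a x} → cutsBefore δ x ≡ cutsBefore δ a → ∀ e → a ≤ e → e < x → cut δ e ≡ 0
  noCutsBetween δ {a} {x} same e a≤e e<x = ℕ.n≤0⇒n≡0 (ℕ.+-cancelˡ-≤ (cutsBefore δ a) _ _
    (subst (cutsBefore δ a ℕ.+ cut δ e ≤_) (trans same (sym (ℕ.+-identityʳ _))) (cutsBefore-cut δ a≤e e<x)))

  node : ℕ → Fin M
  node x = x mod M

  toℕ-node : ∀ x → toℕ (node x) ≡ x % M
  toℕ-node x = toℕ-fromℕ< _

  toℕ-node< : ∀ {x} → x < M → toℕ (node x) ≡ x
  toℕ-node< {x} x<M = trans (toℕ-node x) (m<n⇒m%n≡m x<M)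

  node-M : node M ≡ node 0
  node-M = toℕ-injective (trans (toℕ-node M) (n%n≡0 M))

  Connected : CycleEdgeSet → Fin M → Fin M → Set
  Connected δ = SameComponent (Cycle M) δ

  uncut-path : ∀ δ k a → a ℕ.+ k ≤ M → (∀ e → a ≤ e → e < a ℕ.+ k → cut δ e ≡ 0) →
    Connected δ (node a) (node (a ℕ.+ k))
  uncut-path δ zero    a _       _      = subst (λ b → Connected δ (node a) (node b)) (sym (ℕ.+-identityʳ a)) ε
  uncut-path δ (suc k) a a+1+k≤M uncut =
    step ◅ subst (λ b → Connected δ (node (suc a)) (node b)) (sym (ℕ.+-suc a k))
                 (uncut-path δ k (suc a) 1+a+k≤M (λ e a<e e<1+a+k → uncut e (ℕ.<⇒≤ a<e) (ℕ.≤-trans e<1+a+k (ℕ.≤-reflexive (sym (ℕ.+-suc a k))))))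
    where
    1+a+k≤M : suc a ℕ.+ k ≤ M
    1+a+k≤M = subst (_≤ M) (ℕ.+-suc a k) a+1+k≤M
    a<M : a < M
    a<M = ℕ.≤-trans (s≤s (ℕ.m≤m+n a k)) 1+a+k≤M
    a-uncut : δ (node a) ≡ false
    a-uncut with δ (node a) in δa
    ... | false = refl
    ... | true  with () ← trans (sym (uncut a ℕ.≤-refl (ℕ.m<m+n a (s≤s z≤n))))
                                (trans (cong (cut δ) (sym (toℕ-node< a<M))) (trans (cut-toℕ δ (node a)) (cong (λ b → if b then 1 else 0) δa)))
    next : cycNext (node a) ≡ node (suc a)
    next = toℕ-injective (trans (toℕ-fromℕ< _) (trans (cong (λ b → suc b % M) (toℕ-node< a<M)) (sym (toℕ-node (suc a)))))
    step : Step (Cycle M) δ (node a) (node (suc a))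
    step = node a , a-uncut , inj₁ (cong (node a ,_) next)

  s2n-pair : ∀ {i} → 1 ≤ i → i ≤ N → S2N N (node i) (node (i ℕ.+ N))
  s2n-pair {i} 1≤i i≤N = i , 1≤i , i≤N , inj₁ (toℕ-node< (ℕ.≤-<-trans i≤N (ℕ.m<m+n N (s≤s z≤n))) , toℕ-node (i ℕ.+ N))

  s2n-pair′ : ∀ {i} → 1 ≤ i → i ≤ N → S2N N (node (i ℕ.+ N)) (node i)
  s2n-pair′ {i} 1≤i i≤N = i , 1≤i , i≤N , inj₂ (toℕ-node< (ℕ.≤-<-trans i≤N (ℕ.m<m+n N (s≤s z≤n))) , toℕ-node (i ℕ.+ N))

  i+N≤M : ∀ {i} → i ≤ N → i ℕ.+ N ≤ M
  i+N≤M {i} i≤N = subst (i ℕ.+ N ≤_) (sym M≡N+N) (ℕ.+-monoˡ-≤ N i≤N)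

  -- The antipodes i and i + N are joined by an uncut arc, either [i, i + N) or its complement.
  UncutArc : CycleEdgeSet → ℕ → Set
  UncutArc δ i = cutsBefore δ (i ℕ.+ N) ≡ cutsBefore δ i
               ⊎ (cutsBefore δ i ≡ 0 × cutsBefore δ (i ℕ.+ N) ≡ totalCuts δ)

  uncutArc? : ∀ δ i → Dec (UncutArc δ i)
  uncutArc? δ i = (cutsBefore δ (i ℕ.+ N) ℕ.≟ cutsBefore δ i)
              ⊎-dec ((cutsBefore δ i ℕ.≟ 0) ×-dec (cutsBefore δ (i ℕ.+ N) ℕ.≟ totalCuts δ))

  uncutArc⇒¬multicut : ∀ δ {i} → 1 ≤ i → i ≤ N → UncutArc δ i → ¬ IsMulticut (Cycle M) (S2N N) δ
  uncutArc⇒¬multicut δ {i} 1≤i i≤N (inj₁ inner) multicut =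
    multicut _ _ (s2n-pair 1≤i i≤N) (uncut-path δ N i (i+N≤M i≤N) (noCutsBetween δ inner))
  uncutArc⇒¬multicut δ {i} 1≤i i≤N (inj₂ (before≡0 , after≡total)) multicut =
    multicut _ _ (s2n-pair′ 1≤i i≤N) (toEnd ◅◅ fromStart)
    where
    i+N+rest≡M = ℕ.m+[n∸m]≡n (i+N≤M i≤N)
    toEnd : Connected δ (node (i ℕ.+ N)) (node 0)
    toEnd = subst (Connected δ (node (i ℕ.+ N))) (trans (cong node i+N+rest≡M) node-M)
      (uncut-path δ (M ∸ (i ℕ.+ N)) (i ℕ.+ N) (ℕ.≤-reflexive i+N+rest≡M)
        (λ e i+N≤e e<end → noCutsBetween δ (sym after≡total) e i+N≤e (subst (e <_) i+N+rest≡M e<end)))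
    fromStart : Connected δ (node 0) (node i)
    fromStart = uncut-path δ i 0 (ℕ.≤-trans i≤N (ℕ.m≤m+n N _)) (noCutsBetween δ before≡0)

  squeeze-1 : ∀ {a} → a ≢ 0 → a ≤ 2 → a ≢ 2 → a ≡ 1
  squeeze-1 {zero}             a≢0 _                 _   = ⊥-elim (a≢0 refl)
  squeeze-1 {suc zero}         _   _                 _   = refl
  squeeze-1 {suc (suc zero)}   _   _                 a≢2 = ⊥-elim (a≢2 refl)
  squeeze-1 {suc (suc (suc _))} _  (s≤s (s≤s ()))    _

  squeeze-1-2 : ∀ {a k} → a ≢ 0 → a ≤ k → a ≢ k → k ≤ 2 → a ≡ 1 × k ≡ 2
  squeeze-1-2 {a} {k} a≢0 a≤k a≢k k≤2 = a≡1 , k≡2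
    where
    a≡1 : a ≡ 1
    a≡1 = squeeze-1 a≢0 (ℕ.≤-trans a≤k k≤2) (λ a≡2 → a≢k (ℕ.≤-antisym a≤k (subst (k ≤_) (sym a≡2) k≤2)))
    k≡2 : k ≡ 2
    k≡2 = ℕ.≤-antisym k≤2 (subst (_< k) a≡1 (ℕ.≤∧≢⇒< a≤k a≢k))

  -- Under these hypotheses cutsBefore would vanish on all of [1, N], yet equal 1 at N.
  module NoLightMulticut (δ : CycleEdgeSet) (total≤2 : totalCuts δ ≤ 2)
    (noAntipodalCuts : ∀ i → i < N → cut δ i ≡ 1 → cut δ (i ℕ.+ N) ≡ 1 → ⊥)
    (noUncutArc : ∀ i → 1 ≤ i → i ≤ N → ¬ UncutArc δ i) where

    before2N≡total : cutsBefore δ (N ℕ.+ N) ≡ totalCuts δ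
    before2N≡total = cong (cutsBefore δ) (sym M≡N+N)

    beforeN≡1∧total≡2 : cutsBefore δ N ≡ 1 × totalCuts δ ≡ 2
    beforeN≡1∧total≡2 = squeeze-1-2
      (λ beforeN≡0 → noUncutArc N (s≤s z≤n) ℕ.≤-refl (inj₂ (beforeN≡0 , before2N≡total)))
      (cutsBefore≤totalCuts δ (ℕ.m≤m+n N _))
      (λ beforeN≡total → noUncutArc N (s≤s z≤n) ℕ.≤-refl (inj₁ (trans before2N≡total (sym beforeN≡total))))
      total≤2

    beforeN≡1 : cutsBefore δ N ≡ 1
    beforeN≡1 = proj₁ beforeN≡1∧total≡2

    total≡2 : totalCuts δ ≡ 2
    total≡2 = proj₂ beforeN≡1∧total≡2

    before1≡0 : cutsBefore δ 1 ≡ 0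
    before1≡0 with cut∈01 δ 0
    ... | inj₁ cut0≡0 = trans (cutsBefore-suc δ 0) cut0≡0
    ... | inj₂ cut0≡1 with cut∈01 δ N
    ...   | inj₂ cutN≡1 = ⊥-elim (noAntipodalCuts 0 (s≤s z≤n) cut0≡1 cutN≡1)
    ...   | inj₁ cutN≡0 = ⊥-elim (noUncutArc 1 (s≤s z≤n) (s≤s z≤n) (inj₁
            (trans (cutsBefore-suc δ N) (trans (cong₂ ℕ._+_ beforeN≡1 cutN≡0) (sym (trans (cutsBefore-suc δ 0) cut0≡1))))))

    before-step : ∀ i → 1 ≤ i → suc i ≤ N → cutsBefore δ i ≡ 0 → cutsBefore δ (suc i) ≡ 0
    before-step i 1≤i i<N beforeᵢ≡0 with cut∈01 δ i
    ... | inj₁ cutᵢ≡0 = trans (cutsBefore-suc δ i) (cong₂ ℕ._+_ beforeᵢ≡0 cutᵢ≡0)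
    ... | inj₂ cutᵢ≡1 with cut∈01 δ (i ℕ.+ N)
    ...   | inj₂ cutᵢ₊N≡1 = ⊥-elim (noAntipodalCuts i i<N cutᵢ≡1 cutᵢ₊N≡1)
    ...   | inj₁ cutᵢ₊N≡0 = ⊥-elim (noUncutArc (suc i) (s≤s z≤n) i<N (inj₁
            (trans (cutsBefore-suc δ (i ℕ.+ N)) (trans (cong₂ ℕ._+_ beforeᵢ₊N≡1 cutᵢ₊N≡0)
                   (sym (trans (cutsBefore-suc δ i) (cong₂ ℕ._+_ beforeᵢ≡0 cutᵢ≡1)))))))
      where
      beforeᵢ₊N≡1 : cutsBefore δ (i ℕ.+ N) ≡ 1
      beforeᵢ₊N≡1 = squeeze-1
        (λ ≡0 → noUncutArc i 1≤i (ℕ.<⇒≤ i<N) (inj₁ (trans ≡0 (sym beforeᵢ≡0))))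
        (subst (cutsBefore δ (i ℕ.+ N) ≤_) total≡2 (cutsBefore≤totalCuts δ (i+N≤M (ℕ.<⇒≤ i<N))))
        (λ ≡2 → noUncutArc i 1≤i (ℕ.<⇒≤ i<N) (inj₂ (beforeᵢ≡0 , trans ≡2 (sym total≡2))))

    before≡0 : ∀ i → 1 ≤ i → i ≤ N → cutsBefore δ i ≡ 0
    before≡0 (suc zero)    _ _   = before1≡0
    before≡0 (suc (suc i)) _ i<N = before-step (suc i) (s≤s z≤n) i<N (before≡0 (suc i) (s≤s z≤n) (ℕ.<⇒≤ i<N))

    impossible : ⊥
    impossible with () ← trans (sym (before≡0 N (s≤s z≤n) ℕ.≤-refl)) beforeN≡1

  totalCuts≤weight : ∀ δ → totalCuts δ ≤ weight δ
  totalCuts≤weight δ = subst (_≤ weight δ) (sym total≡sum) (sumℕ-mono-≤ 0 N (λ i →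
    ℕ.+-mono-≤ (x≤kx (α∈12 i) (cut δ i)) (x≤kx (α′∈12 i) (cut δ (i ℕ.+ N)))))
    where
    x≤kx : ∀ {k} → k ≡ 1 ⊎ k ≡ 2 → ∀ x → x ≤ k ℕ.* x
    x≤kx (inj₁ refl) x = ℕ.m≤n*m x 1
    x≤kx (inj₂ refl) x = ℕ.m≤n*m x 2
    total≡sum : totalCuts δ ≡ sumℕ 0 N (λ i → cut δ i ℕ.+ cut δ (i ℕ.+ N))
    total≡sum = trans (cong (λ k → sumℕ 0 k (cut δ)) M≡N+N) (trans (sumℕ-++ 0 N N (cut δ))
      (trans (cong (cutsBefore δ N ℕ.+_) (sumℕ-shift 0 N N (cut δ))) (sym (sumℕ-+ 0 N (cut δ) (λ i → cut δ (i ℕ.+ N))))))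

  antipodalCuts⇒weight≥3 : ∀ δ {i} → i < N → cut δ i ≡ 1 → cut δ (i ℕ.+ N) ≡ 1 → 3 ≤ weight δ
  antipodalCuts⇒weight≥3 δ {i} i<N cutᵢ≡1 cutᵢ₊N≡1 =
    ℕ.≤-trans (ℕ.≤-reflexive (sym termᵢ≡3)) (term≤sumℕ 0 N (weightTerm δ) i z≤n i<N)
    where
    termᵢ≡3 : weightTerm δ i ≡ 3
    termᵢ≡3 = trans (cong₂ (λ u v → α i ℕ.* u ℕ.+ α′ i ℕ.* v) cutᵢ≡1 cutᵢ₊N≡1)
                    (trans (cong₂ ℕ._+_ (ℕ.*-identityʳ (α i)) (ℕ.*-identityʳ (α′ i))) (α+α′≡3 i))

  multicut⇒weight≥3 : ∀ δ → IsMulticut (Cycle M) (S2N N) δ → 3 ≤ weight δ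
  multicut⇒weight≥3 δ multicut with 3 ℕ.≤? weight δ
  ... | yes 3≤weight = 3≤weight
  ... | no  3≰weight with anyUpTo? (λ i → uncutArc? δ (suc i)) N
  ...   | yes (i , i<N , arc) = ⊥-elim (uncutArc⇒¬multicut δ (s≤s z≤n) i<N arc multicut)
  ...   | no  noArc = ⊥-elim (NoLightMulticut.impossible δ
            (ℕ.≤-trans (totalCuts≤weight δ) (ℕ.≤-pred (ℕ.≰⇒> 3≰weight)))
            (λ i i<N cutᵢ≡1 cutᵢ₊N≡1 → 3≰weight (antipodalCuts⇒weight≥3 δ i<N cutᵢ≡1 cutᵢ₊N≡1))
            (λ { (suc i) _ 1+i≤N arc → noArc (i , 1+i≤N , arc) }))

  -- y modulo the total number of cuts, for y ≤ totalCuts δ.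
  wrap : CycleEdgeSet → ℕ → ℕ
  wrap δ y with y ℕ.<? totalCuts δ
  ... | yes _ = y
  ... | no  _ = 0

  wrap-0 : ∀ δ → wrap δ 0 ≡ 0
  wrap-0 δ with 0 ℕ.<? totalCuts δ
  ... | yes _ = refl
  ... | no  _ = refl

  wrap-total : ∀ δ → wrap δ (totalCuts δ) ≡ 0
  wrap-total δ with totalCuts δ ℕ.<? totalCuts δ
  ... | yes total<total = ⊥-elim (ℕ.<-irrefl refl total<total)
  ... | no  _           = refl

  wrap-< : ∀ δ {y} → y < totalCuts δ → wrap δ y ≡ y
  wrap-< δ {y} y<total with y ℕ.<? totalCuts δ
  ... | yes _       = refl
  ... | no  y≮total = ⊥-elim (y≮total y<total)

  wrap-injective : ∀ δ {a y} → a < y → y ≤ totalCuts δ → (1 ≤ a ⊎ y < totalCuts δ) → wrap δ a ≢ wrap δ y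
  wrap-injective δ {a} {y} a<y y≤total notBoth eq with ℕ.m≤n⇒m<n∨m≡n y≤total
  ... | inj₁ y<total = ℕ.<⇒≢ a<y (trans (sym (wrap-< δ (ℕ.<-≤-trans a<y y≤total))) (trans eq (wrap-< δ y<total)))
  ... | inj₂ refl with notBoth
  ...   | inj₂ y<total = ℕ.<-irrefl refl y<total
  ...   | inj₁ 1≤a     = ℕ.<⇒≢ 1≤a (sym (trans (sym (wrap-< δ a<y)) (trans eq (wrap-total δ))))

  -- Cutting the cycle at the cut edges, the component of node x is determined by the number
  -- of cuts before x, except that the last arc continues into the first.
  componentLabel : CycleEdgeSet → ℕ → ℕ
  componentLabel δ x = wrap δ (cutsBefore δ x)

  cutsBefore-uncut : ∀ δ (e : Fin M) → δ e ≡ false → cutsBefore δ (suc (toℕ e)) ≡ cutsBefore δ (toℕ e)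
  cutsBefore-uncut δ e δe≡false = trans (cutsBefore-suc δ (toℕ e))
    (trans (cong (cutsBefore δ (toℕ e) ℕ.+_) (trans (cut-toℕ δ e) (cong (λ b → if b then 1 else 0) δe≡false)))
           (ℕ.+-identityʳ _))

  componentLabel-uncutEdge : ∀ δ (e : Fin M) → δ e ≡ false →
    componentLabel δ (toℕ e) ≡ componentLabel δ (toℕ (cycNext e))
  componentLabel-uncutEdge δ e δe≡false with ℕ.m≤n⇒m<n∨m≡n (toℕ<n e)
  ... | inj₁ 1+e<M = cong (wrap δ) (trans (sym (cutsBefore-uncut δ e δe≡false))
                       (cong (cutsBefore δ) (sym (trans (toℕ-fromℕ< _) (m<n⇒m%n≡m 1+e<M)))))
  ... | inj₂ 1+e≡M = trans (cong (wrap δ) beforeₑ≡total)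
                       (trans (wrap-total δ) (sym (trans (cong (componentLabel δ) next≡0) (wrap-0 δ))))
    where
    beforeₑ≡total : cutsBefore δ (toℕ e) ≡ totalCuts δ
    beforeₑ≡total = trans (sym (cutsBefore-uncut δ e δe≡false)) (cong (cutsBefore δ) 1+e≡M)
    next≡0 : toℕ (cycNext e) ≡ 0
    next≡0 = trans (toℕ-fromℕ< _) (trans (cong (_% M) 1+e≡M) (n%n≡0 M))

  componentLabel-connected : ∀ δ {u v} → Connected δ u v → componentLabel δ (toℕ u) ≡ componentLabel δ (toℕ v)
  componentLabel-connected δ ε = refl
  componentLabel-connected δ ((e , δe≡false , ends≡) ◅ path) =
    trans (along ends≡) (componentLabel-connected δ path)
    where
    label = λ (u : Fin M) → componentLabel δ (toℕ u)
    along : ∀ {u v} → (e , cycNext e) ≡ (u , v) ⊎ (e , cycNext e) ≡ (v , u) → label u ≡ label v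
    along (inj₁ refl) = componentLabel-uncutEdge δ e δe≡false
    along (inj₂ refl) = sym (componentLabel-uncutEdge δ e δe≡false)

  CutsBothArcs : CycleEdgeSet → Set
  CutsBothArcs δ = ∀ i → i < N →
    (∃ λ e → i ≤ e × e < i ℕ.+ N × cut δ e ≡ 1) × (∃ λ e → (e < i ⊎ (i ℕ.+ N ≤ e × e < M)) × cut δ e ≡ 1)

  module _ (δ : CycleEdgeSet) (bothArcs : CutsBothArcs δ) where

    private
      before<before : ∀ {i} → i < N → cutsBefore δ i < cutsBefore δ (i ℕ.+ N)
      before<before {i} i<N with proj₁ (bothArcs i i<N)
      ... | e , i≤e , e<i+N , cutₑ≡1 =
        ℕ.≤-trans (ℕ.≤-reflexive (trans (ℕ.+-comm 1 _) (cong (cutsBefore δ i ℕ.+_) (sym cutₑ≡1))))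
                  (cutsBefore-cut δ i≤e e<i+N)

      outerCut : ∀ {i} → i < N → 1 ≤ cutsBefore δ i ⊎ cutsBefore δ (i ℕ.+ N) < totalCuts δ
      outerCut {i} i<N with proj₂ (bothArcs i i<N)
      ... | e , inj₁ e<i , cutₑ≡1 = inj₁ (subst (_≤ cutsBefore δ i) cutₑ≡1 (cutsBefore-cut δ z≤n e<i))
      ... | e , inj₂ (i+N≤e , e<M) , cutₑ≡1 = inj₂ (ℕ.≤-trans
              (ℕ.≤-reflexive (trans (ℕ.+-comm 1 _) (cong (cutsBefore δ (i ℕ.+ N) ℕ.+_) (sym cutₑ≡1))))
              (cutsBefore-cut δ i+N≤e e<M))

      labels-differ : ∀ {i} → i < N → componentLabel δ i ≢ componentLabel δ (i ℕ.+ N)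
      labels-differ i<N = wrap-injective δ (before<before i<N)
        (cutsBefore≤totalCuts δ (i+N≤M (ℕ.<⇒≤ i<N))) (outerCut i<N)

      labels-differ-0N : componentLabel δ 0 ≢ componentLabel δ N
      labels-differ-0N = labels-differ {0} (s≤s z≤n)

      pair-labels-differ : ∀ {i} → 1 ≤ i → i ≤ N → ∀ (s t : Fin M) →
        toℕ s ≡ i → toℕ t ≡ (i ℕ.+ N) mod' M → componentLabel δ (toℕ s) ≢ componentLabel δ (toℕ t)
      pair-labels-differ {i} 1≤i i≤N s t s≡i t≡i+N same with ℕ.m≤n⇒m<n∨m≡n i≤N
      ... | inj₁ i<N  = labels-differ i<N (trans (cong (componentLabel δ) (sym s≡i)) (trans same (cong (componentLabel δ)
                          (trans t≡i+N (m<n⇒m%n≡m (subst (i ℕ.+ N <_) (sym M≡N+N) (ℕ.+-monoˡ-< N i<N)))))))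
      ... | inj₂ refl = labels-differ-0N (sym (trans (cong (componentLabel δ) (sym s≡i)) (trans same (cong (componentLabel δ)
                          (trans t≡i+N (trans (cong (_% M) (sym M≡N+N)) (n%n≡0 M)))))))

    cutsBothArcs⇒multicut : IsMulticut (Cycle M) (S2N N) δ
    cutsBothArcs⇒multicut s t (i , 1≤i , i≤N , inj₁ (s≡i , t≡i+N)) path =
      pair-labels-differ 1≤i i≤N s t s≡i t≡i+N (componentLabel-connected δ path)
    cutsBothArcs⇒multicut s t (i , 1≤i , i≤N , inj₂ (t≡i , s≡i+N)) path =
      pair-labels-differ 1≤i i≤N t s t≡i s≡i+N (sym (componentLabel-connected δ path))

  i<M : ∀ {i} → i < N → i < M
  i<M i<N = ℕ.<-≤-trans i<N (ℕ.m≤m+n N _)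

  i+N<M : ∀ {i} → i < N → i ℕ.+ N < M
  i+N<M {i} i<N = subst (i ℕ.+ N <_) (sym M≡N+N) (ℕ.+-monoˡ-< N i<N)

  threeCuts⇒cutsBothArcs : ∀ δ {p₁ p₂ p₃} → p₁ < p₂ → p₂ < p₃ → p₃ < M →
    p₂ ≤ p₁ ℕ.+ N → p₃ ≤ p₂ ℕ.+ N → p₁ ℕ.+ N ≤ p₃ →
    cut δ p₁ ≡ 1 → cut δ p₂ ≡ 1 → cut δ p₃ ≡ 1 → CutsBothArcs δ
  threeCuts⇒cutsBothArcs δ {p₁} {p₂} {p₃} p₁<p₂ p₂<p₃ p₃<M p₂≤p₁+N p₃≤p₂+N p₁+N≤p₃ cut₁ cut₂ cut₃ i i<N
    with i ℕ.≤? p₁ | i ℕ.≤? p₂ | i ℕ.≤? p₃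
  ... | yes i≤p₁ | _          | _ = (p₁ , i≤p₁ , ℕ.<-≤-trans p₁<N (ℕ.m≤n+m N i) , cut₁) ,
                                   (p₃ , inj₂ (ℕ.≤-trans (ℕ.+-monoˡ-≤ N i≤p₁) p₁+N≤p₃ , p₃<M) , cut₃)
    where
    p₁<N : p₁ < N
    p₁<N = ℕ.+-cancelʳ-< N p₁ N (ℕ.≤-<-trans p₁+N≤p₃ (subst (p₃ <_) M≡N+N p₃<M))
  ... | no i≰p₁  | yes i≤p₂   | _ = (p₂ , i≤p₂ , ℕ.≤-<-trans p₂≤p₁+N (ℕ.+-monoˡ-< N (ℕ.≰⇒> i≰p₁)) , cut₂) ,
                                   (p₁ , inj₁ (ℕ.≰⇒> i≰p₁) , cut₁)
  ... | no i≰p₁  | no i≰p₂    | yes i≤p₃ = (p₃ , i≤p₃ , ℕ.≤-<-trans p₃≤p₂+N (ℕ.+-monoˡ-< N (ℕ.≰⇒> i≰p₂)) , cut₃) ,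
                                   (p₁ , inj₁ (ℕ.≰⇒> i≰p₁) , cut₁)
  ... | no _     | no _       | no i≰p₃ = ⊥-elim (ℕ.<-irrefl refl
    (ℕ.<-≤-trans (ℕ.<-trans (ℕ.≰⇒> i≰p₃) i<N) (ℕ.≤-trans (ℕ.m≤n+m N p₁) p₁+N≤p₃)))

  antipodalCuts⇒cutsBothArcs : ∀ δ {z} → z < N → cut δ z ≡ 1 → cut δ (z ℕ.+ N) ≡ 1 → CutsBothArcs δ
  antipodalCuts⇒cutsBothArcs δ {z} z<N cut₁ cut₂ i i<N with i ℕ.≤? z
  ... | yes i≤z = (z , i≤z , ℕ.<-≤-trans z<N (ℕ.m≤n+m N i) , cut₁) ,
                  (z ℕ.+ N , inj₂ (ℕ.+-monoˡ-≤ N i≤z , i+N<M z<N) , cut₂)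
  ... | no  i≰z = (z ℕ.+ N , ℕ.≤-trans (ℕ.<⇒≤ i<N) (ℕ.m≤n+m N z) , ℕ.+-monoˡ-< N (ℕ.≰⇒> i≰z) , cut₂) ,
                  (z , inj₁ (ℕ.≰⇒> i≰z) , cut₁)

  toBit : Bool → ℕ
  toBit b = if b then 1 else 0

  infix 5 _∈ᵇ_
  _∈ᵇ_ : ℕ → List ℕ → Bool
  x ∈ᵇ []       = false
  x ∈ᵇ (y ∷ ys) = does (x ℕ.≟ y) ∨ (x ∈ᵇ ys)

  ∈ᵇ-here : ∀ x ys → x ∈ᵇ (x ∷ ys) ≡ true
  ∈ᵇ-here x ys = cong (_∨ (x ∈ᵇ ys)) (dec-true (x ℕ.≟ x) refl)

  ∈ᵇ-there : ∀ x y ys → x ∈ᵇ ys ≡ true → x ∈ᵇ (y ∷ ys) ≡ true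
  ∈ᵇ-there x y ys x∈ys = trans (cong (does (x ℕ.≟ y) ∨_) x∈ys) (∨-zeroʳ _)

  ∈-triple₁ : ∀ x b c → x ∈ᵇ (x ∷ b ∷ c ∷ []) ≡ true
  ∈-triple₁ x b c = ∈ᵇ-here x (b ∷ c ∷ [])

  ∈-triple₂ : ∀ a x c → x ∈ᵇ (a ∷ x ∷ c ∷ []) ≡ true
  ∈-triple₂ a x c = ∈ᵇ-there x a (x ∷ c ∷ []) (∈ᵇ-here x (c ∷ []))

  ∈-triple₃ : ∀ a b x → x ∈ᵇ (a ∷ b ∷ x ∷ []) ≡ true
  ∈-triple₃ a b x = ∈ᵇ-there x a (b ∷ x ∷ []) (∈ᵇ-there x b (x ∷ []) (∈ᵇ-here x []))

  edgesAt : List ℕ → CycleEdgeSet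
  edgesAt E e = toℕ e ∈ᵇ E

  cut-edgesAt : ∀ E {x} → x < M → cut (edgesAt E) x ≡ toBit (x ∈ᵇ E)
  cut-edgesAt E {x} x<M with x ℕ.<? M
  ... | no  x≮M = ⊥-elim (x≮M x<M)
  ... | yes _   = cong (λ z → toBit (z ∈ᵇ E)) (toℕ-fromℕ< _)

  cut-edgesAt-∈ : ∀ E {x} → x < M → x ∈ᵇ E ≡ true → cut (edgesAt E) x ≡ 1
  cut-edgesAt-∈ E x<M x∈E = trans (cut-edgesAt E x<M) (cong toBit x∈E)

  -- The copy of position y < N carrying coefficient 1, and the one carrying 2.
  light heavy : ℕ → ℕ
  light y with α y ℕ.≟ 1
  ... | yes _ = y
  ... | no  _ = y ℕ.+ N
  heavy y with α y ℕ.≟ 1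
  ... | yes _ = y ℕ.+ N
  ... | no  _ = y

  light-α≡1 : ∀ {y} → α y ≡ 1 → light y ≡ y × heavy y ≡ y ℕ.+ N
  light-α≡1 {y} α≡1 with α y ℕ.≟ 1
  ... | yes _   = refl , refl
  ... | no  α≢1 = ⊥-elim (α≢1 α≡1)

  light-α≢1 : ∀ {y} → α y ≢ 1 → light y ≡ y ℕ.+ N × heavy y ≡ y
  light-α≢1 {y} α≢1 with α y ℕ.≟ 1
  ... | yes α≡1 = ⊥-elim (α≢1 α≡1)
  ... | no  _   = refl , refl

  light<M : ∀ {y} → y < N → light y < M
  light<M {y} y<N with α y ℕ.≟ 1
  ... | yes _ = i<M y<N
  ... | no  _ = i+N<M y<N

  i≢y+N : ∀ {i} y → i < N → i ≢ y ℕ.+ N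
  i≢y+N {i} y i<N i≡y+N = ℕ.<⇒≱ i<N (subst (N ≤_) (sym i≡y+N) (ℕ.m≤n+m N y))

  private

    ≡-light : ∀ {i} y → i < N → does (i ℕ.≟ light y) ≡ does (i ℕ.≟ y) ∧ does (α i ℕ.≟ 1)
    ≡-light {i} y i<N with α y ℕ.≟ 1 | i ℕ.≟ y
    ... | yes αy≡1 | yes refl = trans (dec-true (i ℕ.≟ i) refl)
                                  (sym (cong₂ _∧_ (dec-true (i ℕ.≟ i) refl) (dec-true (α i ℕ.≟ 1) αy≡1)))
    ... | yes _    | no i≢y   = trans (dec-false (i ℕ.≟ y) i≢y) (sym (cong (_∧ does (α i ℕ.≟ 1)) (dec-false (i ℕ.≟ y) i≢y)))
    ... | no αy≢1  | yes refl = trans (dec-false (i ℕ.≟ i ℕ.+ N) (i≢y+N i i<N))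
                                  (sym (cong₂ _∧_ (dec-true (i ℕ.≟ i) refl) (dec-false (α i ℕ.≟ 1) αy≢1)))
    ... | no _     | no i≢y   = trans (dec-false (i ℕ.≟ y ℕ.+ N) (i≢y+N y i<N))
                                  (sym (cong (_∧ does (α i ℕ.≟ 1)) (dec-false (i ℕ.≟ y) i≢y)))

    ≡-light+N : ∀ {i y} → i < N → y < N → does (i ℕ.+ N ℕ.≟ light y) ≡ does (i ℕ.≟ y) ∧ not (does (α i ℕ.≟ 1))
    ≡-light+N {i} {y} i<N y<N with α y ℕ.≟ 1 | i ℕ.≟ y
    ... | yes αy≡1 | yes refl = trans (dec-false (i ℕ.+ N ℕ.≟ i) (i≢y+N i i<N ∘ sym))
                                  (sym (cong₂ (λ a b → a ∧ not b) (dec-true (i ℕ.≟ i) refl) (dec-true (α i ℕ.≟ 1) αy≡1)))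
    ... | yes _    | no i≢y   = trans (dec-false (i ℕ.+ N ℕ.≟ y) (i≢y+N i y<N ∘ sym))
                                  (sym (cong (_∧ not (does (α i ℕ.≟ 1))) (dec-false (i ℕ.≟ y) i≢y)))
    ... | no αy≢1  | yes refl = trans (dec-true (i ℕ.+ N ℕ.≟ i ℕ.+ N) refl)
                                  (sym (cong₂ (λ a b → a ∧ not b) (dec-true (i ℕ.≟ i) refl) (dec-false (α i ℕ.≟ 1) αy≢1)))
    ... | no _     | no i≢y   = trans (dec-false (i ℕ.+ N ℕ.≟ y ℕ.+ N) (i≢y ∘ ℕ.+-cancelʳ-≡ N i y))
                                  (sym (cong (_∧ not (does (α i ℕ.≟ 1))) (dec-false (i ℕ.≟ y) i≢y)))

  ∈ᵇ-lights : ∀ ys {i} → i < N → i ∈ᵇ map light ys ≡ (i ∈ᵇ ys) ∧ does (α i ℕ.≟ 1)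
  ∈ᵇ-lights []       i<N = refl
  ∈ᵇ-lights (y ∷ ys) {i} i<N = trans (cong₂ _∨_ (≡-light y i<N) (∈ᵇ-lights ys i<N))
    (sym (∧-distribʳ-∨ (does (α i ℕ.≟ 1)) (does (i ℕ.≟ y)) (i ∈ᵇ ys)))

  ∈ᵇ-lights+N : ∀ ys {i} → i < N → All (_< N) ys → i ℕ.+ N ∈ᵇ map light ys ≡ (i ∈ᵇ ys) ∧ not (does (α i ℕ.≟ 1))
  ∈ᵇ-lights+N []       i<N []              = refl
  ∈ᵇ-lights+N (y ∷ ys) {i} i<N (y<N ∷ ys<N) = trans (cong₂ _∨_ (≡-light+N i<N y<N) (∈ᵇ-lights+N ys i<N ys<N))
    (sym (∧-distribʳ-∨ (not (does (α i ℕ.≟ 1))) (does (i ℕ.≟ y)) (i ∈ᵇ ys)))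

  weightTerm-lights : ∀ ys {i} → i < N → All (_< N) ys → weightTerm (edgesAt (map light ys)) i ≡ toBit (i ∈ᵇ ys)
  weightTerm-lights ys {i} i<N ys<N =
    trans (cong₂ (λ u v → α i ℕ.* u ℕ.+ α′ i ℕ.* v)
            (trans (cut-edgesAt (map light ys) (i<M i<N)) (cong toBit (∈ᵇ-lights ys i<N)))
            (trans (cut-edgesAt (map light ys) (i+N<M i<N)) (cong toBit (∈ᵇ-lights+N ys i<N ys<N))))
          (split (α i) (α′ i) (i ∈ᵇ ys) (α-values i))
    where
    split : ∀ a a′ m → (a ≡ 1 × a′ ≡ 2) ⊎ (a ≡ 2 × a′ ≡ 1) →
      a ℕ.* toBit (m ∧ does (a ℕ.≟ 1)) ℕ.+ a′ ℕ.* toBit (m ∧ not (does (a ℕ.≟ 1))) ≡ toBit m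
    split .1 .2 true  (inj₁ (refl , refl)) = refl
    split .1 .2 false (inj₁ (refl , refl)) = refl
    split .2 .1 true  (inj₂ (refl , refl)) = refl
    split .2 .1 false (inj₂ (refl , refl)) = refl

  Distinct : List ℕ → Set
  Distinct []       = ⊤
  Distinct (y ∷ ys) = y ∈ᵇ ys ≡ false × Distinct ys

  count-∈ᵇ : ∀ ys → All (_< N) ys → Distinct ys → sumℕ 0 N (λ i → toBit (i ∈ᵇ ys)) ≡ length ys
  count-∈ᵇ []       _              _               = zeros 0 N
    where
    zeros : ∀ a k → sumℕ a k (λ _ → 0) ≡ 0
    zeros a zero    = refl
    zeros a (suc k) = zeros (suc a) k
  count-∈ᵇ (y ∷ ys) (y<N ∷ ys<N) (y∉ys , distinct) =
    trans (sumℕ-congᵢ 0 N (λ i _ _ → toBit-∨ (does (i ℕ.≟ y)) (i ∈ᵇ ys) (exclusive i)))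
    (trans (sumℕ-+ 0 N (λ i → toBit (does (i ℕ.≟ y))) (λ i → toBit (i ∈ᵇ ys)))
           (cong₂ ℕ._+_ count-y (count-∈ᵇ ys ys<N distinct)))
    where
    toBit-∨ : ∀ p q → (p ≡ true → q ≡ false) → toBit (p ∨ q) ≡ toBit p ℕ.+ toBit q
    toBit-∨ true  q p→¬q = cong (λ b → 1 ℕ.+ toBit b) (sym (p→¬q refl))
    toBit-∨ false q _    = refl
    exclusive : ∀ i → does (i ℕ.≟ y) ≡ true → i ∈ᵇ ys ≡ false
    exclusive i i≡ᵇy with i ℕ.≟ y
    ... | yes refl = y∉ys
    ... | no  i≢y  with () ← trans (sym i≡ᵇy) (dec-false (i ℕ.≟ y) i≢y)
    count-y : sumℕ 0 N (λ i → toBit (does (i ℕ.≟ y))) ≡ 1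
    count-y = trans (sumℕ-single 0 N _ y z≤n y<N (λ i _ _ i≢y → cong toBit (dec-false (i ℕ.≟ y) i≢y)))
                    (cong toBit (dec-true (y ℕ.≟ y) refl))

  weight-lights : ∀ ys → All (_< N) ys → Distinct ys → weight (edgesAt (map light ys)) ≡ length ys
  weight-lights ys ys<N distinct =
    trans (sumℕ-congᵢ 0 N (λ i _ i<N → weightTerm-lights ys i<N ys<N)) (count-∈ᵇ ys ys<N distinct)

  -- Three positions whose lights alternate between the two halves of the cycle.
  record AlternatingTriple (y₁ y₂ y₃ : ℕ) : Set where
    field
      y₁<y₂ : y₁ < y₂
      y₂<y₃ : y₂ < y₃
      y₃<N  : y₃ < N
      α₁≢α₂ : α y₁ ≢ α y₂
      α₂≢α₃ : α y₂ ≢ α y₃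

    y₂<N : y₂ < N
    y₂<N = ℕ.<-trans y₂<y₃ y₃<N

    y₁<N : y₁ < N
    y₁<N = ℕ.<-trans y₁<y₂ y₂<N

    all<N : All (_< N) (y₁ ∷ y₂ ∷ y₃ ∷ [])
    all<N = y₁<N ∷ y₂<N ∷ y₃<N ∷ []

  tripleCut : ℕ → ℕ → ℕ → CycleEdgeSet
  tripleCut y₁ y₂ y₃ = edgesAt (map light (y₁ ∷ y₂ ∷ y₃ ∷ []))

  α≢1⇒α≡2 : ∀ y → α y ≢ 1 → α y ≡ 2
  α≢1⇒α≡2 y α≢1 with α∈12 y
  ... | inj₁ α≡1 = ⊥-elim (α≢1 α≡1)
  ... | inj₂ α≡2 = α≡2

  α≢2⇒α≡1 : ∀ y → α y ≢ 2 → α y ≡ 1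
  α≢2⇒α≡1 y α≢2 with α∈12 y
  ... | inj₁ α≡1 = α≡1
  ... | inj₂ α≡2 = ⊥-elim (α≢2 α≡2)

  module _ {y₁ y₂ y₃} (T : AlternatingTriple y₁ y₂ y₃) where
    open AlternatingTriple T

    private
      δ : CycleEdgeSet
      δ = tripleCut y₁ y₂ y₃
      E : List ℕ
      E = map light (y₁ ∷ y₂ ∷ y₃ ∷ [])

      cut-light₁ : cut δ (light y₁) ≡ 1
      cut-light₁ = cut-edgesAt-∈ E (light<M y₁<N) (∈-triple₁ (light y₁) (light y₂) (light y₃))
      cut-light₂ : cut δ (light y₂) ≡ 1
      cut-light₂ = cut-edgesAt-∈ E (light<M y₂<N) (∈-triple₂ (light y₁) (light y₂) (light y₃))
      cut-light₃ : cut δ (light y₃) ≡ 1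
      cut-light₃ = cut-edgesAt-∈ E (light<M y₃<N) (∈-triple₃ (light y₁) (light y₂) (light y₃))

      cutsBothArcs : Dec (α y₁ ≡ 1) → CutsBothArcs δ
      cutsBothArcs (yes α₁≡1) = threeCuts⇒cutsBothArcs δ
        (ℕ.<-trans y₁<y₂ y₂<y₃) (ℕ.<-≤-trans y₃<N (ℕ.m≤n+m N y₂)) (i+N<M y₂<N)
        (ℕ.<⇒≤ (ℕ.<-≤-trans y₃<N (ℕ.m≤n+m N y₁))) (ℕ.<⇒≤ (ℕ.+-monoˡ-< N y₂<y₃)) (ℕ.<⇒≤ (ℕ.+-monoˡ-< N y₁<y₂))
        (subst (λ p → cut δ p ≡ 1) (proj₁ (light-α≡1 α₁≡1)) cut-light₁)
        (subst (λ p → cut δ p ≡ 1) (proj₁ (light-α≡1 α₃≡1)) cut-light₃)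
        (subst (λ p → cut δ p ≡ 1) (proj₁ (light-α≢1 α₂≢1)) cut-light₂)
        where
        α₂≢1 : α y₂ ≢ 1
        α₂≢1 α₂≡1 = α₁≢α₂ (trans α₁≡1 (sym α₂≡1))
        α₃≡1 : α y₃ ≡ 1
        α₃≡1 = α≢2⇒α≡1 y₃ (λ α₃≡2 → α₂≢α₃ (trans (α≢1⇒α≡2 y₂ α₂≢1) (sym α₃≡2)))
      cutsBothArcs (no α₁≢1) = threeCuts⇒cutsBothArcs δ
        (ℕ.<-≤-trans y₂<N (ℕ.m≤n+m N y₁)) (ℕ.+-monoˡ-< N (ℕ.<-trans y₁<y₂ y₂<y₃)) (i+N<M y₃<N)
        (ℕ.<⇒≤ (ℕ.+-monoˡ-< N y₁<y₂)) (ℕ.<⇒≤ (ℕ.<-≤-trans (ℕ.+-monoˡ-< N y₃<N) (ℕ.+-monoˡ-≤ N (ℕ.m≤n+m N y₁))))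
        (ℕ.<⇒≤ (ℕ.+-monoˡ-< N y₂<y₃))
        (subst (λ p → cut δ p ≡ 1) (proj₁ (light-α≡1 α₂≡1)) cut-light₂)
        (subst (λ p → cut δ p ≡ 1) (proj₁ (light-α≢1 α₁≢1)) cut-light₁)
        (subst (λ p → cut δ p ≡ 1) (proj₁ (light-α≢1 α₃≢1)) cut-light₃)
        where
        α₂≡1 : α y₂ ≡ 1
        α₂≡1 = α≢2⇒α≡1 y₂ (λ α₂≡2 → α₁≢α₂ (trans (α≢1⇒α≡2 y₁ α₁≢1) (sym α₂≡2)))
        α₃≢1 : α y₃ ≢ 1
        α₃≢1 α₃≡1 = α₂≢α₃ (trans α₂≡1 (sym α₃≡1))

    tripleCut-multicut : IsMulticut (Cycle M) (S2N N) (tripleCut y₁ y₂ y₃)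
    tripleCut-multicut = cutsBothArcs⇒multicut δ (cutsBothArcs (α y₁ ℕ.≟ 1))

    tripleCut-weight : weight (tripleCut y₁ y₂ y₃) ≡ 3
    tripleCut-weight = weight-lights (y₁ ∷ y₂ ∷ y₃ ∷ []) all<N
      ( cong₂ _∨_ (dec-false (y₁ ℕ.≟ y₂) (ℕ.<⇒≢ y₁<y₂))
          (cong₂ _∨_ (dec-false (y₁ ℕ.≟ y₃) (ℕ.<⇒≢ (ℕ.<-trans y₁<y₂ y₂<y₃))) refl)
      , cong₂ _∨_ (dec-false (y₂ ℕ.≟ y₃) (ℕ.<⇒≢ y₂<y₃)) refl , refl , _ )

  antipodalCut : ℕ → CycleEdgeSet
  antipodalCut z = edgesAt (z ∷ z ℕ.+ N ∷ [])

  module _ {z} (z<N : z < N) where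

    private
      E : List ℕ
      E = z ∷ z ℕ.+ N ∷ []

      z∈E : z ∈ᵇ E ≡ true
      z∈E = ∈ᵇ-here z (z ℕ.+ N ∷ [])

      z+N∈E : z ℕ.+ N ∈ᵇ E ≡ true
      z+N∈E = ∈ᵇ-there (z ℕ.+ N) z (z ℕ.+ N ∷ []) (∈ᵇ-here (z ℕ.+ N) [])

    antipodalCut-∈ᵇ : ∀ {i} → i < N → i ∈ᵇ E ≡ does (i ℕ.≟ z)
    antipodalCut-∈ᵇ {i} i<N = trans (cong (λ b → does (i ℕ.≟ z) ∨ (b ∨ false)) (dec-false (i ℕ.≟ z ℕ.+ N) (i≢y+N z i<N)))
                                    (trans (cong (does (i ℕ.≟ z) ∨_) (∨-identityʳ false)) (∨-identityʳ _))

    antipodalCut-∈ᵇ+N : ∀ {i} → i < N → i ℕ.+ N ∈ᵇ E ≡ does (i ℕ.≟ z)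
    antipodalCut-∈ᵇ+N {i} i<N with i ℕ.≟ z
    ... | yes refl = trans z+N∈E (sym (dec-true (i ℕ.≟ i) refl))
    ... | no  i≢z  = trans (cong₂ _∨_ (dec-false (i ℕ.+ N ℕ.≟ z) (i≢y+N i z<N ∘ sym))
                                       (cong (_∨ false) (dec-false (i ℕ.+ N ℕ.≟ z ℕ.+ N) (i≢z ∘ ℕ.+-cancelʳ-≡ N i z))))
                           (sym (dec-false (i ℕ.≟ z) i≢z))

    antipodalCut-multicut : IsMulticut (Cycle M) (S2N N) (antipodalCut z)
    antipodalCut-multicut = cutsBothArcs⇒multicut (antipodalCut z) (antipodalCuts⇒cutsBothArcs (antipodalCut z) z<N
      (cut-edgesAt-∈ E (i<M z<N) z∈E) (cut-edgesAt-∈ E (i+N<M z<N) z+N∈E))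

    antipodalCut-weight : weight (antipodalCut z) ≡ 3
    antipodalCut-weight = trans (sumℕ-congᵢ 0 N (λ i _ i<N → term i<N))
      (trans (sumℕ-single 0 N (λ i → 3 ℕ.* toBit (does (i ℕ.≟ z))) z z≤n z<N
               (λ i _ _ i≢z → cong (λ b → 3 ℕ.* toBit b) (dec-false (i ℕ.≟ z) i≢z)))
             (cong (λ b → 3 ℕ.* toBit b) (dec-true (z ℕ.≟ z) refl)))
      where
      term : ∀ {i} → i < N → weightTerm (antipodalCut z) i ≡ 3 ℕ.* toBit (does (i ℕ.≟ z))
      term {i} i<N = trans (cong₂ (λ u v → α i ℕ.* u ℕ.+ α′ i ℕ.* v)
                             (trans (cut-edgesAt E (i<M i<N)) (cong toBit (antipodalCut-∈ᵇ i<N)))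
                             (trans (cut-edgesAt E (i+N<M i<N)) (cong toBit (antipodalCut-∈ᵇ+N i<N))))
                     (trans (sym (ℕ.*-distribʳ-+ (toBit (does (i ℕ.≟ z))) (α i) (α′ i)))
                            (cong (ℕ._* toBit (does (i ℕ.≟ z))) (α+α′≡3 i)))

  allCut : CycleEdgeSet
  allCut _ = true

  cut-allCut : ∀ {i} → i < M → cut allCut i ≡ 1
  cut-allCut {i} i<M with i ℕ.<? M
  ... | yes _   = refl
  ... | no  i≮M = ⊥-elim (i≮M i<M)

  allCut-multicut : IsMulticut (Cycle M) (S2N N) allCut
  allCut-multicut = cutsBothArcs⇒multicut allCut (antipodalCuts⇒cutsBothArcs allCut {0} (s≤s z≤n)
    (cut-allCut (i<M (s≤s z≤n))) (cut-allCut (i+N<M (s≤s z≤n))))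

  allCut-weight≥6 : 6 ≤ weight allCut
  allCut-weight≥6 = first-two N 2≤N ℕ.≤-refl
    where
    term≡3 : ∀ {i} → i < N → weightTerm allCut i ≡ 3
    term≡3 {i} i<N = trans (cong₂ (λ u v → α i ℕ.* u ℕ.+ α′ i ℕ.* v) (cut-allCut (i<M i<N)) (cut-allCut (i+N<M i<N)))
                           (trans (cong₂ ℕ._+_ (ℕ.*-identityʳ (α i)) (ℕ.*-identityʳ (α′ i))) (α+α′≡3 i))
    2≤N : 2 ≤ N
    2≤N = ℕ.≤-trans (s≤s (s≤s z≤n)) (ℕ.≤-trans 5≤n n≤N)
    first-two : ∀ k → 2 ≤ k → k ≤ N → 6 ≤ sumℕ 0 k (weightTerm allCut)
    first-two (suc zero) (s≤s ()) _
    first-two (suc (suc k)) _ k≤N = subst₂ (λ u v → 6 ≤ u ℕ.+ (v ℕ.+ sumℕ 2 k (weightTerm allCut)))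
      (sym (term≡3 (ℕ.<-≤-trans (s≤s z≤n) k≤N))) (sym (term≡3 (ℕ.<-≤-trans (s≤s (s≤s z≤n)) k≤N)))
      (ℕ.m≤m+n 6 _)

  β₁≢β₂ : betaJ β 1 ≢ betaJ β 2
  β₁≢β₂ with β∈12
  ... | inj₁ refl = λ ()
  ... | inj₂ refl = λ ()

  α-anchor : ∀ {k} → k < 5 → α (ℓ k) ≡ betaJ β (suc k)
  α-anchor {k} k<5 = cong (betaJ β) (block-unique record
    { 1≤J = s≤s z≤n ; J≤n = ℕ.≤-trans k<5 5≤n ; lower = ℕ.≤-refl ; upper = ℓ-increasing k (ℕ.≤-trans k<5 5≤n) })

  ≤4⇒≤n : ∀ {k} → k ≤ 4 → k ≤ n
  ≤4⇒≤n k≤4 = ℕ.≤-trans k≤4 (ℕ.≤-trans (ℕ.n≤1+n 4) 5≤n)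

  ≤4 : ∀ {k} {k≤4 : True (k ℕ.≤? 4)} → k ≤ 4
  ≤4 {k≤4 = k≤4} = toWitness k≤4

  ℓ4<N : ℓ 4 < N
  ℓ4<N = subst (ℓ 4 <_) ℓn≡N (ℓ-mono-< 5≤n ℕ.≤-refl)

  ℓ-anchor<N : ∀ {k} → k ≤ 4 → ℓ k < N
  ℓ-anchor<N k≤4 = ℕ.≤-<-trans (ℓ-mono-≤ k≤4 (≤4⇒≤n ℕ.≤-refl)) ℓ4<N

  ℓ-anchor-< : ∀ a b → {True (suc a ℕ.≤? b)} → {True (b ℕ.≤? 4)} → ℓ a < ℓ b
  ℓ-anchor-< a b {a<b} {b≤4} = ℓ-mono-< (toWitness a<b) (≤4⇒≤n (toWitness b≤4))

  α-anchors-differ : ∀ a b → {True (a ℕ.≤? 4)} → {True (b ℕ.≤? 4)} →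
    betaJ β (suc a) ≢ betaJ β (suc b) → α (ℓ a) ≢ α (ℓ b)
  α-anchors-differ a b {a≤4} {b≤4} β≢β αa≡αb =
    β≢β (trans (sym (α-anchor (s≤s (toWitness a≤4)))) (trans αa≡αb (α-anchor (s≤s (toWitness b≤4)))))

  Triple : Set
  Triple = ℕ × ℕ × ℕ

  Alternating : Triple → Set
  Alternating (y₁ , y₂ , y₃) = AlternatingTriple y₁ y₂ y₃

  members : Triple → List ℕ
  members (y₁ , y₂ , y₃) = y₁ ∷ y₂ ∷ y₃ ∷ []

  cutAt : Triple → CycleEdgeSet
  cutAt t = edgesAt (map light (members t))

  -- The five cyclically consecutive triples of block indices {k, k+1, k+2} mod 5.
  anchorIndices : Fin 5 → Triple
  anchorIndices zero                         = 0 , 1 , 2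
  anchorIndices (suc zero)                   = 1 , 2 , 3
  anchorIndices (suc (suc zero))             = 2 , 3 , 4
  anchorIndices (suc (suc (suc zero)))       = 0 , 3 , 4
  anchorIndices (suc (suc (suc (suc zero)))) = 0 , 1 , 4

  anchorTriple : Fin 5 → Triple
  anchorTriple k = let (a , b , c) = anchorIndices k in ℓ a , ℓ b , ℓ c

  anchorTriple-alternating : ∀ k → Alternating (anchorTriple k)
  anchorTriple-alternating zero = record
    { y₁<y₂ = ℓ-anchor-< 0 1 ; y₂<y₃ = ℓ-anchor-< 1 2 ; y₃<N = ℓ-anchor<N (s≤s (s≤s z≤n))
    ; α₁≢α₂ = α-anchors-differ 0 1 β₁≢β₂ ; α₂≢α₃ = α-anchors-differ 1 2 (β₁≢β₂ ∘ sym) }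
  anchorTriple-alternating (suc zero) = record
    { y₁<y₂ = ℓ-anchor-< 1 2 ; y₂<y₃ = ℓ-anchor-< 2 3 ; y₃<N = ℓ-anchor<N (s≤s (s≤s (s≤s z≤n)))
    ; α₁≢α₂ = α-anchors-differ 1 2 (β₁≢β₂ ∘ sym) ; α₂≢α₃ = α-anchors-differ 2 3 β₁≢β₂ }
  anchorTriple-alternating (suc (suc zero)) = record
    { y₁<y₂ = ℓ-anchor-< 2 3 ; y₂<y₃ = ℓ-anchor-< 3 4 ; y₃<N = ℓ4<N
    ; α₁≢α₂ = α-anchors-differ 2 3 β₁≢β₂ ; α₂≢α₃ = α-anchors-differ 3 4 (β₁≢β₂ ∘ sym) }
  anchorTriple-alternating (suc (suc (suc zero))) = record
    { y₁<y₂ = ℓ-anchor-< 0 3 ; y₂<y₃ = ℓ-anchor-< 3 4 ; y₃<N = ℓ4<N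
    ; α₁≢α₂ = α-anchors-differ 0 3 β₁≢β₂ ; α₂≢α₃ = α-anchors-differ 3 4 (β₁≢β₂ ∘ sym) }
  anchorTriple-alternating (suc (suc (suc (suc zero)))) = record
    { y₁<y₂ = ℓ-anchor-< 0 1 ; y₂<y₃ = ℓ-anchor-< 1 4 ; y₃<N = ℓ4<N
    ; α₁≢α₂ = α-anchors-differ 0 1 β₁≢β₂ ; α₂≢α₃ = α-anchors-differ 1 4 (β₁≢β₂ ∘ sym) }

  freeTripleᵈ : ∀ x → Dec (block x ≡ 1) → Dec (block x ≡ 2) → Dec (α x ≡ α (ℓ 0)) → Triple
  freeTripleᵈ x (yes _) _       _       = x   , ℓ 1 , ℓ 2
  freeTripleᵈ x (no _)  (yes _) _       = ℓ 0 , x   , ℓ 2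
  freeTripleᵈ x (no _)  (no _)  (yes _) = ℓ 0 , ℓ 1 , x
  freeTripleᵈ x (no _)  (no _)  (no _)  = ℓ 1 , ℓ 2 , x

  freeTriple : ℕ → Triple
  freeTriple x = freeTripleᵈ x (block x ℕ.≟ 1) (block x ℕ.≟ 2) (α x ℕ.≟ α (ℓ 0))

  betaJ-other : ∀ {j} → betaJ β j ≢ betaJ β 1 → betaJ β j ≡ betaJ β 2
  betaJ-other {j} ≢β₁ with betaJ-values j | betaJ-values 1 | betaJ-values 2
  ... | inj₁ (b≡1 , _) | inj₁ (b₁≡1 , _) | _              = ⊥-elim (≢β₁ (trans b≡1 (sym b₁≡1)))
  ... | inj₂ (b≡2 , _) | inj₂ (b₁≡2 , _) | _              = ⊥-elim (≢β₁ (trans b≡2 (sym b₁≡2)))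
  ... | inj₁ (b≡1 , _) | inj₂ _          | inj₁ (b₂≡1 , _) = trans b≡1 (sym b₂≡1)
  ... | inj₂ (b≡2 , _) | inj₁ _          | inj₂ (b₂≡2 , _) = trans b≡2 (sym b₂≡2)
  ... | _              | inj₁ (b₁≡1 , _) | inj₁ (b₂≡1 , _) = ⊥-elim (β₁≢β₂ (trans b₁≡1 (sym b₂≡1)))
  ... | _              | inj₂ (b₁≡2 , _) | inj₂ (b₂≡2 , _) = ⊥-elim (β₁≢β₂ (trans b₁≡2 (sym b₂≡2)))

  module _ {x} (x<N : x < N) where
    open InBlock (block-inBlock x<N)

    private
      α₀ : α (ℓ 0) ≡ betaJ β 1
      α₀ = α-anchor (s≤s z≤n)

      block≥3 : block x ≢ 1 → block x ≢ 2 → 3 ≤ block x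
      block≥3 ≢1 ≢2 with block x | 1≤J
      ... | suc zero          | _ = ⊥-elim (≢1 refl)
      ... | suc (suc zero)    | _ = ⊥-elim (≢2 refl)
      ... | suc (suc (suc _)) | _ = s≤s (s≤s (s≤s z≤n))

      ℓ≤x : ∀ {k} → k ≤ block x ∸ 1 → ℓ k ≤ x
      ℓ≤x k≤ = ℕ.≤-trans (ℓ-mono-≤ k≤ (ℕ.≤-trans (ℕ.m∸n≤m (block x) 1) J≤n)) lower

    freeTripleᵈ-alternating : ∀ d₁ d₂ d₃ → Alternating (freeTripleᵈ x d₁ d₂ d₃)
    freeTripleᵈ-alternating (yes block≡1) _ _ = record
      { y₁<y₂ = subst (λ j → x < ℓ j) block≡1 upper ; y₂<y₃ = ℓ-anchor-< 1 2 ; y₃<N = ℓ-anchor<N (s≤s (s≤s z≤n))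
      ; α₁≢α₂ = λ α≡ → β₁≢β₂ (trans (sym (cong (betaJ β) block≡1)) (trans α≡ (α-anchor (s≤s (s≤s z≤n)))))
      ; α₂≢α₃ = α-anchors-differ 1 2 (β₁≢β₂ ∘ sym) }
    freeTripleᵈ-alternating (no _) (yes block≡2) _ = record
      { y₁<y₂ = ℕ.<-≤-trans (ℓ-anchor-< 0 1) (subst (λ j → ℓ (j ∸ 1) ≤ x) block≡2 lower)
      ; y₂<y₃ = subst (λ j → x < ℓ j) block≡2 upper ; y₃<N = ℓ-anchor<N (s≤s (s≤s z≤n))
      ; α₁≢α₂ = λ α≡ → β₁≢β₂ (trans (sym α₀) (trans α≡ (cong (betaJ β) block≡2)))
      ; α₂≢α₃ = λ α≡ → β₁≢β₂ (sym (trans (sym (cong (betaJ β) block≡2)) (trans α≡ (α-anchor (s≤s (s≤s (s≤s z≤n))))))) }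
    freeTripleᵈ-alternating (no ≢1) (no ≢2) (yes α≡α₀) = record
      { y₁<y₂ = ℓ-anchor-< 0 1 ; y₂<y₃ = ℕ.<-≤-trans (ℓ-anchor-< 1 2) (ℓ≤x (ℕ.∸-monoˡ-≤ 1 (block≥3 ≢1 ≢2))) ; y₃<N = x<N
      ; α₁≢α₂ = α-anchors-differ 0 1 β₁≢β₂
      ; α₂≢α₃ = λ α≡ → β₁≢β₂ (sym (trans (sym (α-anchor (s≤s (s≤s z≤n)))) (trans α≡ (trans α≡α₀ α₀)))) }
    freeTripleᵈ-alternating (no ≢1) (no ≢2) (no α≢α₀) = record
      { y₁<y₂ = ℓ-anchor-< 1 2 ; y₂<y₃ = ℕ.<-≤-trans (ℓ-anchor-< 2 3) (ℓ≤x (ℕ.∸-monoˡ-≤ 1 block≥4)) ; y₃<N = x<N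
      ; α₁≢α₂ = α-anchors-differ 1 2 (β₁≢β₂ ∘ sym)
      ; α₂≢α₃ = λ α≡ → β₁≢β₂ (trans (sym (α-anchor (s≤s (s≤s (s≤s z≤n))))) (trans α≡ αx≡β₂)) }
      where
      αx≡β₂ : α x ≡ betaJ β 2
      αx≡β₂ = betaJ-other {block x} (λ α≡β₁ → α≢α₀ (trans α≡β₁ (sym α₀)))
      block≥4 : 4 ≤ block x
      block≥4 with ℕ.m≤n⇒m<n∨m≡n (block≥3 ≢1 ≢2)
      ... | inj₁ 3<block = 3<block
      ... | inj₂ 3≡block = ⊥-elim (α≢α₀ (trans (cong (betaJ β) (sym 3≡block)) (sym α₀)))

  freeTriple-alternating : ∀ {x} → x < N → Alternating (freeTriple x)
  freeTriple-alternating {x} x<N = freeTripleᵈ-alternating x<N (block x ℕ.≟ 1) (block x ℕ.≟ 2) (α x ℕ.≟ α (ℓ 0))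

  -- Affinely independent points on the face

  NonAnchor : ℕ → Set
  NonAnchor x = ∀ (k : Fin 5) → x ≢ ℓ (toℕ k)

  anchor? : ∀ x → (Σ (Fin 5) λ k → x ≡ ℓ (toℕ k)) ⊎ NonAnchor x
  anchor? x with any? (λ k → x ℕ.≟ ℓ (toℕ k))
  ... | yes anchor   = inj₁ anchor
  ... | no  ¬anchor = inj₂ (λ k x≡ℓk → ¬anchor (k , x≡ℓk))

  -- The M face points: antipodal cuts for positions z < N, and for a position N + x an
  -- anchor triple if x is one of ℓ 0, …, ℓ 4, and the free triple of x otherwise.
  data FacePoint : Set where
    antipodal : ℕ → FacePoint
    anchored  : Fin 5 → FacePoint
    free      : ℕ → FacePoint

  Valid : FacePoint → Set
  Valid (antipodal z) = z < N
  Valid (anchored k)  = ⊤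
  Valid (free x)      = x < N × NonAnchor x

  position : FacePoint → ℕ
  position (antipodal z) = z
  position (anchored k)  = N ℕ.+ ℓ (toℕ k)
  position (free x)      = N ℕ.+ x

  facePointᵈ : ∀ v → Dec (v < N) → (Σ (Fin 5) λ k → v ∸ N ≡ ℓ (toℕ k)) ⊎ NonAnchor (v ∸ N) → FacePoint
  facePointᵈ v (yes _) _              = antipodal v
  facePointᵈ v (no _)  (inj₁ (k , _)) = anchored k
  facePointᵈ v (no _)  (inj₂ _)       = free (v ∸ N)

  facePoint : Fin M → FacePoint
  facePoint e = facePointᵈ (toℕ e) (toℕ e ℕ.<? N) (anchor? (toℕ e ∸ N))

  position-facePointᵈ : ∀ v d a → position (facePointᵈ v d a) ≡ v
  position-facePointᵈ v (yes _)  _                  = refl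
  position-facePointᵈ v (no v≮N) (inj₁ (k , v-N≡ℓk)) = trans (cong (N ℕ.+_) (sym v-N≡ℓk)) (ℕ.m+[n∸m]≡n (ℕ.≮⇒≥ v≮N))
  position-facePointᵈ v (no v≮N) (inj₂ _)           = ℕ.m+[n∸m]≡n (ℕ.≮⇒≥ v≮N)

  facePoint-injective : ∀ {i j} → facePoint i ≡ facePoint j → i ≡ j
  facePoint-injective {i} {j} same = toℕ-injective (trans (sym (position-facePoint i))
    (trans (cong position same) (position-facePoint j)))
    where
    position-facePoint : ∀ e → position (facePoint e) ≡ toℕ e
    position-facePoint e = position-facePointᵈ (toℕ e) (toℕ e ℕ.<? N) (anchor? (toℕ e ∸ N))

  facePoint-valid : ∀ e → Valid (facePoint e)
  facePoint-valid e = go (toℕ e) (toℕ<n e) (toℕ e ℕ.<? N) (anchor? (toℕ e ∸ N))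
    where
    go : ∀ v → v < M → ∀ d a → Valid (facePointᵈ v d a)
    go v _   (yes v<N) _          = v<N
    go v _   (no _)    (inj₁ _)   = tt
    go v v<M (no v≮N)  (inj₂ non) = ℕ.+-cancelˡ-< N (v ∸ N) N
      (subst (_< N ℕ.+ N) (sym (ℕ.m+[n∸m]≡n (ℕ.≮⇒≥ v≮N))) (subst (v <_) M≡N+N v<M)) , non

  cutOf : FacePoint → CycleEdgeSet
  cutOf (antipodal z) = antipodalCut z
  cutOf (anchored k)  = cutAt (anchorTriple k)
  cutOf (free x)      = cutAt (freeTriple x)

  cutAt-multicut : ∀ t → Alternating t → IsMulticut (Cycle M) (S2N N) (cutAt t)
  cutAt-multicut (y₁ , y₂ , y₃) = tripleCut-multicut

  cutAt-weight : ∀ t → Alternating t → weight (cutAt t) ≡ 3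
  cutAt-weight (y₁ , y₂ , y₃) = tripleCut-weight

  cutOf-multicut : ∀ L → Valid L → IsMulticut (Cycle M) (S2N N) (cutOf L)
  cutOf-multicut (antipodal z) z<N         = antipodalCut-multicut z<N
  cutOf-multicut (anchored k)  _           = cutAt-multicut _ (anchorTriple-alternating k)
  cutOf-multicut (free x)      (x<N , _)   = cutAt-multicut _ (freeTriple-alternating x<N)

  cutOf-weight : ∀ L → Valid L → weight (cutOf L) ≡ 3
  cutOf-weight (antipodal z) z<N       = antipodalCut-weight z<N
  cutOf-weight (anchored k)  _         = cutAt-weight _ (anchorTriple-alternating k)
  cutOf-weight (free x)      (x<N , _) = cutAt-weight _ (freeTriple-alternating x<N)

  Δ : ℕ → Vecℚ M → ℚ
  Δ y x = coord x (light y) - coord x (heavy y)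

  Δ-linear : ∀ y → IsLinear (Δ y)
  Δ-linear y = IsLinear-difference (coord-linear (light y)) (coord-linear (heavy y))

  coord-edgesAt : ∀ E {i} → i < M → coord (incidence (edgesAt E)) i ≡ ι (toBit (i ∈ᵇ E))
  coord-edgesAt E {i} i<M = trans (coord-incidence (edgesAt E) i) (cong ι (cut-edgesAt E i<M))

  Δ-lights : ∀ ys → All (_< N) ys → ∀ {y} → y < N → Δ y (incidence (edgesAt (map light ys))) ≡ ι (toBit (y ∈ᵇ ys))
  Δ-lights ys ys<N {y} y<N = go (α y ℕ.≟ 1)
    where
    x = incidence (edgesAt (map light ys))
    m = y ∈ᵇ ys
    atY : coord x y ≡ ι (toBit (m ∧ does (α y ℕ.≟ 1)))
    atY = trans (coord-edgesAt (map light ys) (i<M y<N)) (cong (ι ∘ toBit) (∈ᵇ-lights ys y<N))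
    atY+N : coord x (y ℕ.+ N) ≡ ι (toBit (m ∧ not (does (α y ℕ.≟ 1))))
    atY+N = trans (coord-edgesAt (map light ys) (i+N<M y<N)) (cong (ι ∘ toBit) (∈ᵇ-lights+N ys y<N ys<N))
    go : Dec (α y ≡ 1) → Δ y x ≡ ι (toBit m)
    go (yes α≡1) = begin
      coord x (light y) - coord x (heavy y)
        ≡⟨ cong₂ (λ u v → coord x u - coord x v) (proj₁ (light-α≡1 α≡1)) (proj₂ (light-α≡1 α≡1)) ⟩
      coord x y - coord x (y ℕ.+ N)
        ≡⟨ cong₂ _-_ (trans atY (cong (λ b → ι (toBit (m ∧ b))) (dec-true (α y ℕ.≟ 1) α≡1)))
                     (trans atY+N (cong (λ b → ι (toBit (m ∧ not b))) (dec-true (α y ℕ.≟ 1) α≡1))) ⟩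
      ι (toBit (m ∧ true)) - ι (toBit (m ∧ false))
        ≡⟨ cong₂ (λ u v → ι (toBit u) - ι (toBit v)) (∧-identityʳ m) (∧-zeroʳ m) ⟩
      ι (toBit m) - 0ℚ
        ≡⟨ ℚ.+-identityʳ _ ⟩
      ι (toBit m) ∎
      where open ≡-Reasoning
    go (no α≢1) = begin
      coord x (light y) - coord x (heavy y)
        ≡⟨ cong₂ (λ u v → coord x u - coord x v) (proj₁ (light-α≢1 α≢1)) (proj₂ (light-α≢1 α≢1)) ⟩
      coord x (y ℕ.+ N) - coord x y
        ≡⟨ cong₂ _-_ (trans atY+N (cong (λ b → ι (toBit (m ∧ not b))) (dec-false (α y ℕ.≟ 1) α≢1)))
                     (trans atY (cong (λ b → ι (toBit (m ∧ b))) (dec-false (α y ℕ.≟ 1) α≢1))) ⟩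
      ι (toBit (m ∧ true)) - ι (toBit (m ∧ false))
        ≡⟨ cong₂ (λ u v → ι (toBit u) - ι (toBit v)) (∧-identityʳ m) (∧-zeroʳ m) ⟩
      ι (toBit m) - 0ℚ
        ≡⟨ ℚ.+-identityʳ _ ⟩
      ι (toBit m) ∎
      where open ≡-Reasoning

  Δ-antipodalCut : ∀ {z} → z < N → ∀ {y} → y < N → Δ y (incidence (antipodalCut z)) ≡ 0ℚ
  Δ-antipodalCut {z} z<N {y} y<N = trans (cong₂ _-_ (sameAt (light y) (light∈ (α y ℕ.≟ 1))) (sameAt (heavy y) (heavy∈ (α y ℕ.≟ 1))))
                                        (ℚ.+-inverseʳ v)
    where
    x = incidence (antipodalCut z)
    v = ι (toBit (does (y ℕ.≟ z)))
    atY : coord x y ≡ v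
    atY = trans (coord-edgesAt (z ∷ z ℕ.+ N ∷ []) (i<M y<N)) (cong (ι ∘ toBit) (antipodalCut-∈ᵇ z<N y<N))
    atY+N : coord x (y ℕ.+ N) ≡ v
    atY+N = trans (coord-edgesAt (z ∷ z ℕ.+ N ∷ []) (i+N<M y<N)) (cong (ι ∘ toBit) (antipodalCut-∈ᵇ+N z<N y<N))
    sameAt : ∀ p → p ≡ y ⊎ p ≡ y ℕ.+ N → coord x p ≡ v
    sameAt p (inj₁ refl) = atY
    sameAt p (inj₂ refl) = atY+N
    light∈ : Dec (α y ≡ 1) → light y ≡ y ⊎ light y ≡ y ℕ.+ N
    light∈ (yes α≡1) = inj₁ (proj₁ (light-α≡1 α≡1))
    light∈ (no  α≢1) = inj₂ (proj₁ (light-α≢1 α≢1))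
    heavy∈ : Dec (α y ≡ 1) → heavy y ≡ y ⊎ heavy y ≡ y ℕ.+ N
    heavy∈ (yes α≡1) = inj₂ (proj₂ (light-α≡1 α≡1))
    heavy∈ (no  α≢1) = inj₁ (proj₂ (light-α≢1 α≢1))

  -- Row k of 3·A⁻¹ for the incidence matrix A of the five cyclic triples {j, j+1, j+2} mod 5:
  -- weight 2 on k and k + 2, and −1 elsewhere.
  anchorWeight : Fin 5 → Fin 5 → ℚ
  anchorWeight k m = if does (toℕ m ℕ.≟ toℕ k) ∨ does (toℕ m ℕ.≟ (toℕ k ℕ.+ 2) ℕ.% 5) then ι 2 else - 1ℚ

  anchorPairing : Fin 5 → Fin 5 → ℚ
  anchorPairing k j = sumFin 5 (λ m → anchorWeight k m * ι (toBit (toℕ m ∈ᵇ members (anchorIndices j))))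

  anchorPairing-diagonal : ∀ k j → anchorPairing k j ≡ (if does (k Fin.≟ j) then ι 3 else 0ℚ)
  anchorPairing-diagonal = toWitness {a? = all? λ k → all? λ j → anchorPairing k j ≟ (if does (k Fin.≟ j) then ι 3 else 0ℚ)} _

  functional : FacePoint → Vecℚ M → ℚ
  functional (antipodal z) x = coord x z
  functional (anchored k)  x = sumFin 5 (λ m → anchorWeight k m * Δ (ℓ (toℕ m)) x)
  functional (free y)      x = Δ y x

  functional-linear : ∀ L → IsLinear (functional L)
  functional-linear (antipodal z) = coord-linear z
  functional-linear (anchored k)  = IsLinear-combination 5 (anchorWeight k) (λ m → Δ-linear (ℓ (toℕ m)))
  functional-linear (free y)      = Δ-linear y

  pairing : FacePoint → FacePoint → ℚ
  pairing L L′ = functional L (incidence (cutOf L′))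

  rank : FacePoint → ℕ
  rank (free _)      = 0
  rank (anchored _)  = 1
  rank (antipodal _) = 2

  Δ-cutAt : ∀ t → Alternating t → ∀ {y} → y < N → Δ y (incidence (cutAt t)) ≡ ι (toBit (y ∈ᵇ members t))
  Δ-cutAt (y₁ , y₂ , y₃) T = Δ-lights (y₁ ∷ y₂ ∷ y₃ ∷ []) (AlternatingTriple.all<N T)

  ∉-triple : ∀ {x a b c} → x ≢ a → x ≢ b → x ≢ c → x ∈ᵇ (a ∷ b ∷ c ∷ []) ≡ false
  ∉-triple {x} {a} {b} {c} x≢a x≢b x≢c = cong₂ _∨_ (dec-false (x ℕ.≟ a) x≢a)
    (cong₂ _∨_ (dec-false (x ℕ.≟ b) x≢b) (cong (_∨ false) (dec-false (x ℕ.≟ c) x≢c)))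

  ∈-freeTripleᵈ : ∀ x d₁ d₂ d₃ → x ∈ᵇ members (freeTripleᵈ x d₁ d₂ d₃) ≡ true
  ∈-freeTripleᵈ x (yes _) _       _       = ∈-triple₁ x _ _
  ∈-freeTripleᵈ x (no _)  (yes _) _       = ∈-triple₂ _ x _
  ∈-freeTripleᵈ x (no _)  (no _)  (yes _) = ∈-triple₃ _ _ x
  ∈-freeTripleᵈ x (no _)  (no _)  (no _)  = ∈-triple₃ _ _ x

  module _ {x} (non : NonAnchor x) where
    private
      ≢ℓ : ∀ k {k<5 : True (k ℕ.<? 5)} → x ≢ ℓ k
      ≢ℓ k {k<5} = subst (λ j → x ≢ ℓ j) (toℕ-fromℕ< (toWitness k<5)) (non (fromℕ< (toWitness k<5)))

    ∉-freeTripleᵈ : ∀ {x′} d₁ d₂ d₃ → x ≢ x′ → x ∈ᵇ members (freeTripleᵈ x′ d₁ d₂ d₃) ≡ false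
    ∉-freeTripleᵈ (yes _) _       _       x≢x′ = ∉-triple x≢x′ (≢ℓ 1) (≢ℓ 2)
    ∉-freeTripleᵈ (no _)  (yes _) _       x≢x′ = ∉-triple (≢ℓ 0) x≢x′ (≢ℓ 2)
    ∉-freeTripleᵈ (no _)  (no _)  (yes _) x≢x′ = ∉-triple (≢ℓ 0) (≢ℓ 1) x≢x′
    ∉-freeTripleᵈ (no _)  (no _)  (no _)  x≢x′ = ∉-triple (≢ℓ 1) (≢ℓ 2) x≢x′

    ∉-anchorTriple : ∀ k → x ∈ᵇ members (anchorTriple k) ≡ false
    ∉-anchorTriple zero                         = ∉-triple (≢ℓ 0) (≢ℓ 1) (≢ℓ 2)
    ∉-anchorTriple (suc zero)                   = ∉-triple (≢ℓ 1) (≢ℓ 2) (≢ℓ 3)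
    ∉-anchorTriple (suc (suc zero))             = ∉-triple (≢ℓ 2) (≢ℓ 3) (≢ℓ 4)
    ∉-anchorTriple (suc (suc (suc zero)))       = ∉-triple (≢ℓ 0) (≢ℓ 3) (≢ℓ 4)
    ∉-anchorTriple (suc (suc (suc (suc zero)))) = ∉-triple (≢ℓ 0) (≢ℓ 1) (≢ℓ 4)

  ℓ-injective-≤4 : ∀ {a b} → a ≤ 4 → b ≤ 4 → ℓ a ≡ ℓ b → a ≡ b
  ℓ-injective-≤4 {a} {b} a≤4 b≤4 ℓa≡ℓb with ℕ.<-cmp a b
  ... | tri< a<b _ _ = ⊥-elim (ℕ.<⇒≢ (ℓ-mono-< a<b (≤4⇒≤n b≤4)) ℓa≡ℓb)
  ... | tri≈ _ a≡b _ = a≡b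
  ... | tri> _ _ b<a = ⊥-elim (ℕ.<⇒≢ (ℓ-mono-< b<a (≤4⇒≤n a≤4)) (sym ℓa≡ℓb))

  ℓ-∈ᵇ-map : ∀ {m} → m ≤ 4 → ∀ ys → All (_≤ 4) ys → ℓ m ∈ᵇ map ℓ ys ≡ m ∈ᵇ ys
  ℓ-∈ᵇ-map m≤4 []       []              = refl
  ℓ-∈ᵇ-map {m} m≤4 (y ∷ ys) (y≤4 ∷ ys≤4) = cong₂ _∨_ same (ℓ-∈ᵇ-map m≤4 ys ys≤4)
    where
    same : does (ℓ m ℕ.≟ ℓ y) ≡ does (m ℕ.≟ y)
    same with m ℕ.≟ y
    ... | yes refl = trans (dec-true (ℓ m ℕ.≟ ℓ m) refl) (sym (dec-true (m ℕ.≟ m) refl))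
    ... | no  m≢y  = trans (dec-false (ℓ m ℕ.≟ ℓ y) (m≢y ∘ ℓ-injective-≤4 m≤4 y≤4)) (sym (dec-false (m ℕ.≟ y) m≢y))

  anchorIndices-≤4 : ∀ j → All (_≤ 4) (members (anchorIndices j))
  anchorIndices-≤4 zero                         = ≤4 ∷ ≤4 ∷ ≤4 ∷ []
  anchorIndices-≤4 (suc zero)                   = ≤4 ∷ ≤4 ∷ ≤4 ∷ []
  anchorIndices-≤4 (suc (suc zero))             = ≤4 ∷ ≤4 ∷ ≤4 ∷ []
  anchorIndices-≤4 (suc (suc (suc zero)))       = ≤4 ∷ ≤4 ∷ ≤4 ∷ []
  anchorIndices-≤4 (suc (suc (suc (suc zero)))) = ≤4 ∷ ≤4 ∷ ≤4 ∷ []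

  pairing-antipodal : ∀ {z z′} → z < N → z′ < N → pairing (antipodal z) (antipodal z′) ≡ ι (toBit (does (z ℕ.≟ z′)))
  pairing-antipodal {z} {z′} z<N z′<N =
    trans (coord-edgesAt (z′ ∷ z′ ℕ.+ N ∷ []) (i<M z<N)) (cong (ι ∘ toBit) (antipodalCut-∈ᵇ z′<N z<N))

  pairing-anchored : ∀ k j → pairing (anchored k) (anchored j) ≡ anchorPairing k j
  pairing-anchored k j = sumFin-cong 5 (λ m → cong (anchorWeight k m *_)
    (trans (Δ-cutAt (anchorTriple j) (anchorTriple-alternating j) (ℓ-anchor<N (m≤4 m)))
           (cong (ι ∘ toBit) (ℓ-∈ᵇ-map (m≤4 m) (members (anchorIndices j)) (anchorIndices-≤4 j)))))
    where
    m≤4 : ∀ (m : Fin 5) → toℕ m ≤ 4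
    m≤4 m = ℕ.≤-pred (toℕ<n m)

  pairing-anchored-antipodal : ∀ k {z} → z < N → pairing (anchored k) (antipodal z) ≡ 0ℚ
  pairing-anchored-antipodal k z<N = sumFin-zero 5 (λ m → trans
    (cong (anchorWeight k m *_) (Δ-antipodalCut z<N (ℓ-anchor<N (ℕ.≤-pred (toℕ<n m))))) (ℚ.*-zeroʳ (anchorWeight k m)))

  pairing-diagonal : ∀ L → Valid L → pairing L L ≢ 0ℚ
  pairing-diagonal (antipodal z) z<N ≡0 with () ← trans (sym (trans (pairing-antipodal z<N z<N)
    (cong (ι ∘ toBit) (dec-true (z ℕ.≟ z) refl)))) ≡0
  pairing-diagonal (anchored k) _ ≡0 with () ← trans (sym (trans (pairing-anchored k k)
    (trans (anchorPairing-diagonal k k) (cong (λ b → if b then ι 3 else 0ℚ) (dec-true (k Fin.≟ k) refl))))) ≡0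
  pairing-diagonal (free x) (x<N , _) ≡0 with () ← trans (sym (trans (Δ-cutAt (freeTriple x) (freeTriple-alternating x<N) x<N)
    (cong (ι ∘ toBit) (∈-freeTripleᵈ x (block x ℕ.≟ 1) (block x ℕ.≟ 2) (α x ℕ.≟ α (ℓ 0)))))) ≡0

  pairing-upper : ∀ L L′ → Valid L → Valid L′ → L′ ≢ L → rank L ≤ rank L′ → pairing L L′ ≡ 0ℚ
  pairing-upper (free x) (free x′) (x<N , non) (x′<N , _) L′≢L _ =
    trans (Δ-cutAt (freeTriple x′) (freeTriple-alternating x′<N) x<N)
          (cong (ι ∘ toBit) (∉-freeTripleᵈ non (block x′ ℕ.≟ 1) (block x′ ℕ.≟ 2) (α x′ ℕ.≟ α (ℓ 0)) (L′≢L ∘ cong free ∘ sym)))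
  pairing-upper (free x) (anchored j) (x<N , non) _ _ _ =
    trans (Δ-cutAt (anchorTriple j) (anchorTriple-alternating j) x<N) (cong (ι ∘ toBit) (∉-anchorTriple non j))
  pairing-upper (free x)      (antipodal z) (x<N , _) z<N _ _ = Δ-antipodalCut z<N x<N
  pairing-upper (anchored k)  (anchored j)  _ _ j≢k _ =
    trans (pairing-anchored k j) (trans (anchorPairing-diagonal k j)
          (cong (λ b → if b then ι 3 else 0ℚ) (dec-false (k Fin.≟ j) (j≢k ∘ cong anchored ∘ sym))))
  pairing-upper (anchored k)  (antipodal z) _ z<N _ _ = pairing-anchored-antipodal k z<N
  pairing-upper (antipodal z) (antipodal z′) z<N z′<N z′≢z _ =
    trans (pairing-antipodal z<N z′<N) (cong (ι ∘ toBit) (dec-false (z ℕ.≟ z′) (z′≢z ∘ cong antipodal ∘ sym)))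
  pairing-upper (anchored _)  (free _)     _ _ _ ()
  pairing-upper (antipodal _) (free _)     _ _ _ ()
  pairing-upper (antipodal _) (anchored _) _ _ _ (s≤s ())

  facePoints : Fin M → Vecℚ M
  facePoints e = incidence (cutOf (facePoint e))

  facePoints-affinelyIndependent : AffinelyIndependent M facePoints
  facePoints-affinelyIndependent λs _ λs·p≡0 =
    triangular-kernel λs (λ i j → pairing (facePoint i) (facePoint j)) (rank ∘ facePoint)
      (λ i → homo-combination≡0 (functional-linear (facePoint i)) M λs facePoints λs·p≡0)
      (λ i → pairing-diagonal (facePoint i) (facePoint-valid i))
      (λ i j j≢i → pairing-upper (facePoint i) (facePoint j) (facePoint-valid i) (facePoint-valid j) (j≢i ∘ facePoint-injective))

  F : Vecℚ M → ℚ
  F = cycleLHS n N ℓ β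

  multicut-valid : ∀ δ → IsMulticut (Cycle M) (S2N N) δ → ℚof 3 ≤ℚ F (incidence δ)
  multicut-valid δ multicut = subst (ι 3 ≤ℚ_) (sym (cycleLHS-incidence δ)) (ι-mono-≤ (multicut⇒weight≥3 δ multicut))

  convex-valid : ∀ x → MultCBox (Cycle M) (S2N N) x → ℚof 3 ≤ℚ F x
  convex-valid x (L , valid , Σw≡1 , x≡ΣwL) = subst₂ _≤ℚ_
    (trans (sumList-*ʳ L (ℚof 3)) (trans (cong (_* ℚof 3) Σw≡1) (ℚ.*-identityˡ _)))
    (sym (trans (resp-≗ cycleLHS-linear x≡ΣwL) (homo-convex cycleLHS-linear L)))
    (weighted L valid)
    where
    sumList-*ʳ : ∀ (L : List (ℚ × CycleEdgeSet)) c →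
      sumList (λ { (w , δ) → w * c }) L ≡ sumList (λ { (w , δ) → w }) L * c
    sumList-*ʳ []            c = sym (ℚ.*-zeroˡ c)
    sumList-*ʳ ((w , δ) ∷ L) c = trans (cong (w * c Data.Rational.+_) (sumList-*ʳ L c)) (sym (ℚ.*-distribʳ-+ c w _))
    weighted : ∀ L → All (λ { (w , δ) → 0ℚ ≤ℚ w × IsMulticut (Cycle M) (S2N N) δ }) L →
      sumList (λ { (w , δ) → w * ℚof 3 }) L ≤ℚ sumList (λ { (w , δ) → w * F (incidence δ) }) L
    weighted []            []                       = ℚ.≤-refl
    weighted ((w , δ) ∷ L) ((0≤w , multicut) ∷ all) =
      ℚ.+-mono-≤ (ℚ.*-monoˡ-≤-nonNeg w {{nonNegative 0≤w}} (multicut-valid δ multicut)) (weighted L all)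

  dominant-valid : ∀ x → MultCDom (Cycle M) (S2N N) x → ℚof 3 ≤ℚ F x
  dominant-valid x (y , y∈box , y≤x) = ℚ.≤-trans (convex-valid y y∈box) (cycleLHS-mono-≤ y≤x)

  multicut∈box : ∀ δ → IsMulticut (Cycle M) (S2N N) δ → MultCBox (Cycle M) (S2N N) (incidence δ)
  multicut∈box δ multicut =
    ((1ℚ , δ) ∷ []) , ((ℚ.<⇒≤ (ℚ.positive⁻¹ 1ℚ) , multicut) ∷ []) , refl ,
    (λ e → sym (trans (ℚ.+-identityʳ _) (ℚ.*-identityˡ _)))

  box⊆dominant : ∀ x → MultCBox (Cycle M) (S2N N) x → MultCDom (Cycle M) (S2N N) x
  box⊆dominant x x∈box = x , x∈box , (λ _ → ℚ.≤-refl)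

  allCut-offFace : F (incidence allCut) ≢ ℚof 3
  allCut-offFace F≡3 = ℚ.<-irrefl (sym (trans (sym (cycleLHS-incidence allCut)) F≡3))
    (ι-mono-< (ℕ.≤-trans (s≤s (s≤s (s≤s (s≤s z≤n)))) allCut-weight≥6))

  facePoints-onFace : ∀ j → F (facePoints j) ≡ ℚof 3
  facePoints-onFace j = trans (cycleLHS-incidence (cutOf (facePoint j))) (cong ι (cutOf-weight (facePoint j) (facePoint-valid j)))

  facePoints-multicut : ∀ j → IsMulticut (Cycle M) (S2N N) (cutOf (facePoint j))
  facePoints-multicut j = cutOf-multicut (facePoint j) (facePoint-valid j)

  module _ (Q : Vecℚ M → Set) (Q-valid : ∀ x → Q x → ℚof 3 ≤ℚ F x)
           (multicut∈Q : ∀ δ → IsMulticut (Cycle M) (S2N N) δ → Q (incidence δ)) where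

    facetDefining : FacetDefining Q F (ℚof 3)
    facetDefining = Q-valid , ℕ.pred M , fullDim , faceDim
      where
      fullDim : HasDim Q M
      fullDim = (incidence allCut ∷ᵥ facePoints , inQ , independent) , λ p _ → ¬AffinelyIndependent-beyondDim M p
        where
        inQ : ∀ i → Q ((incidence allCut ∷ᵥ facePoints) i)
        inQ Fin.zero    = multicut∈Q allCut allCut-multicut
        inQ (Fin.suc j) = multicut∈Q _ (facePoints-multicut j)
        independent : AffinelyIndependent (suc M) (incidence allCut ∷ᵥ facePoints)
        independent = affinelyIndependent-∷ cycleLHS-linear (ℚof 3) (incidence allCut) facePoints
                        allCut-offFace facePoints-onFace facePoints-affinelyIndependent
      faceDim : HasDim (λ x → Q x × F x ≡ ℚof 3) (ℕ.pred M)
      faceDim = (facePoints , (λ j → multicut∈Q _ (facePoints-multicut j) , facePoints-onFace j) , facePoints-affinelyIndependent) ,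
                λ p onFace → ¬AffinelyIndependent-onHyperplane M cycleLHS-linear (ℚof 3) (λ ()) p (λ i → proj₂ (onFace i))

  sharedFacet : SharedFacet (Cycle M) (S2N N) F (ℚof 3)
  sharedFacet = facetDefining (MultCDom (Cycle M) (S2N N)) dominant-valid (λ δ → box⊆dominant _ ∘ multicut∈box δ)
              , facetDefining (MultCBox (Cycle M) (S2N N)) convex-valid multicut∈box

theorem7p4 : (n N : ℕ) (ℓ : ℕ → ℕ) (β : ℕ) →
    (∃[ k ] n ≡ suc (2 ℕ.* k)) → 5 ≤ n → n ≤ N →
    ℓ 0 ≡ 0 → (∀ j → j < n → ℓ j < ℓ (suc j)) → ℓ n ≡ N →
    (β ≡ 1 ⊎ β ≡ 2) →
    SharedFacet (Cycle (2 ℕ.* N)) (S2N N) (cycleLHS n N ℓ β) (ℚof 3)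
theorem7p4 n zero      ℓ β _ 5≤n n≤0 _ _ _ _ with () ← ℕ.≤-trans 5≤n n≤0
theorem7p4 n (suc N₀) ℓ β _ 5≤n n≤N ℓ0≡0 ℓ-increasing ℓn≡N β∈12 = CycleFacet.sharedFacet record
  { n = n ; N₀ = N₀ ; β = β ; ℓ = ℓ ; 5≤n = 5≤n ; n≤N = n≤N ; ℓ0≡0 = ℓ0≡0
  ; ℓ-increasing = ℓ-increasing ; ℓn≡N = ℓn≡N ; β∈12 = β∈12 }
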